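{- Let $m\in\mathbb{Z}_{\ge2}$, let $r_0,\ldots,r_s\in\mathbb{N}$ with $r_0+\cdots+r_s=m$, and let $n_0>n_1>\cdots>n_s\ge 0$ be integers. Let $\mathbf{n}\in\mathbb{Z}_{\ge0}^m$ be the index consisting of $r_0$ entries equal to $n_0$, followed by $r_1$ entries equal to $n_1$, ..., followed by $r_s$ entries equal to $n_s$. Define rational numbers $a_{h,j}$ ($0\le h\le n_0$, $1\le j\le m$) by the partial fraction decomposition $$\frac{1}{\prod_{h=0}^{n_s}(x-h)^{m}}\cdot \frac{1}{\prod_{h=n_s+1}^{n_{s-1}}(x-h)^{\sum_{i=0}^{s-1}r_i}}\cdots \frac{1}{\prod_{h=n_1+1}^{n_{0}}(x-h)^{r_0}} =\sum_{h=0}^{n_0} \sum_{j=1}^{m}\frac{a_{h,j}}{(x-h)^j}.$$ Then the formal power series $$R(z)=\sum_{j=0}^{m-1} \left( \frac{\sum_{h=0}^{n_0}a_{h,j+1}(1+z)^h}{j!}\right) \log^{j}(1+z)$$ is a weight $\mathbf{n}$ Padé approximation of $(1,\log(1+z),\ldots,\log^{m-1}(1+z))$.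
   Context: $\log(1+z)=\sum_{k\ge1}(-1)^{k+1}z^k/k\in\mathbb{Q}[[z]]$. For $\mathbf{f}=(f_1,\ldots,f_r)\in K[[z]]^r$ and $\mathbf{n}=(n_1,\ldots,n_r)\in\mathbb{Z}_{\ge0}^r$, a weight $\mathbf{n}$ Padé approximation of $\mathbf f$ is a series $\sum_jA_jf_j$ with $(A_1,\ldots,A_r)\in K[z]^r$ not all zero, $\deg A_j\le n_j$, and $\mathrm{ord}\sum_jA_jf_j\ge\sum_{j}(n_j+1)-1$ ($\mathrm{ord}$ = $z$-adic order). -}

module Defs where

open import Data.Nat as ℕ using (ℕ; zero; suc; _∸_; _<ᵇ_; _≤ᵇ_)
open import Data.Nat using (_!)
open import Data.Integer using (+_; +[1+_]; -[1+_])
open import Data.Rational using (ℚ; mkℚ; 0ℚ; 1ℚ; _+_; _*_; _-_; -_; 1/_; _/_)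
open import Data.Fin using (Fin; toℕ) renaming (zero to fzero; suc to fsuc)
open import Data.Bool using (if_then_else_)
open import Data.Product using (Σ; _×_)
open import Relation.Binary.PropositionalEquality using (_≡_; _≢_)
open import Relation.Nullary using (¬_)

sumFinℕ : ∀ {k} → (Fin k → ℕ) → ℕ
sumFinℕ {zero}  f = 0
sumFinℕ {suc k} f = f fzero ℕ.+ sumFinℕ (λ i → f (fsuc i))

sumFinℚ : ∀ {k} → (Fin k → ℚ) → ℚ
sumFinℚ {zero}  f = 0ℚ
sumFinℚ {suc k} f = f fzero + sumFinℚ (λ i → f (fsuc i))

-- sumℚ a b f = Σ_{i = a}^{b} f i  (empty if b < a)
sumUpTo : ℕ → (ℕ → ℚ) → ℚ
sumUpTo zero    f = 0ℚ
sumUpTo (suc N) f = sumUpTo N f + f N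

sumℚ : ℕ → ℕ → (ℕ → ℚ) → ℚ
sumℚ a b f = sumUpTo (suc b ∸ a) (λ i → f (a ℕ.+ i))

prodUpTo : ℕ → (ℕ → ℚ) → ℚ
prodUpTo zero    f = 1ℚ
prodUpTo (suc N) f = prodUpTo N f * f N

fromℕℚ : ℕ → ℚ
fromℕℚ n = + n / 1

_^ℚ_ : ℚ → ℕ → ℚ
q ^ℚ zero  = 1ℚ
q ^ℚ suc n = q * (q ^ℚ n)

-- total inverse: inv 0 = 0, inv q = 1/q otherwise
-- (only ever applied to nonzero arguments below)
inv : ℚ → ℚ
inv (mkℚ (+ zero)    _ _) = 0ℚ
inv p@(mkℚ +[1+ n ]  _ _) = 1/ p
inv p@(mkℚ -[1+ n ]  _ _) = 1/ p

Series : Set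
Series = ℕ → ℚ

_+ₛ_ : Series → Series → Series
(f +ₛ g) k = f k + g k

_·ₛ_ : ℚ → Series → Series
(c ·ₛ f) k = c * f k

_*ₛ_ : Series → Series → Series
(f *ₛ g) k = sumℚ 0 k (λ i → f i * g (k ∸ i))

oneₛ : Series
oneₛ zero    = 1ℚ
oneₛ (suc k) = 0ℚ

_^ₛ_ : Series → ℕ → Series
f ^ₛ zero  = oneₛ
f ^ₛ suc n = f *ₛ (f ^ₛ n)

onePlusZ : Series
onePlusZ zero          = 1ℚ
onePlusZ (suc zero)    = 1ℚ
onePlusZ (suc (suc k)) = 0ℚ

log1p : Series
log1p zero    = 0ℚ
log1p (suc k) = ((- 1ℚ) ^ℚ k) * (+ 1 / suc k)

sumFinₛ : ∀ {r} → (Fin r → Series) → Series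
sumFinₛ F k = sumFinℚ (λ j → F j k)

-- A polynomial A ∈ ℚ[z] with deg A ≤ d is a coefficient sequence with
-- A k = 0 for all k > d.

IsPadeApprox : ∀ {r} → (n : Fin r → ℕ) → (f : Fin r → Series) → Series → Set
IsPadeApprox {r} n f F =
  Σ (Fin r → Series) λ A →
      (∀ j k → n j ℕ.< k → A j k ≡ 0ℚ)
    × ¬ (∀ j k → A j k ≡ 0ℚ)
    × (∀ k → F k ≡ sumFinₛ (λ j → A j *ₛ f j) k)
    × (∀ k → k ℕ.< sumFinℕ (λ j → suc (n j)) ∸ 1 → F k ≡ 0ℚ)

-- The p-th entry (0-based) of the index consisting of r_0 copies of n_0,
-- then r_1 copies of n_1, …, then r_s copies of n_s.
blockEntry : ∀ {k} → (Fin k → ℕ) → (Fin k → ℕ) → ℕ → ℕ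
blockEntry {zero}  r ns p = 0
blockEntry {suc k} r ns p =
  if p <ᵇ r fzero then ns fzero
  else blockEntry (λ i → r (fsuc i)) (λ i → ns (fsuc i)) (p ∸ r fzero)

-- exponent of (x - h) in the denominator of the left-hand side:
-- e_h = Σ_{i : h ≤ n_i} r_i  (= r_0+…+r_i for n_{i+1} < h ≤ n_i, = m for h ≤ n_s)
expo : ∀ {k} → (Fin k → ℕ) → (Fin k → ℕ) → ℕ → ℕ
expo r ns h = sumFinℕ (λ i → if h ≤ᵇ ns i then r i else 0)

-- a : ℕ → ℕ → ℚ (a h j = a_{h,j}) is the partial fraction decomposition:
-- as rational functions, 1 / Π_{h=0}^{n_0} (x-h)^{e_h} = Σ_{h=0}^{n_0} Σ_{j=1}^{m} a_{h,j}/(x-h)^j,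
-- i.e. equality at every x ∈ ℚ \ {0,…,n_0}.
IsPartialFraction : ∀ {k} → (r ns : Fin (suc k) → ℕ) → ℕ → (ℕ → ℕ → ℚ) → Set
IsPartialFraction r ns m a =
  ∀ (x : ℚ) → (∀ h → h ℕ.≤ ns fzero → x ≢ fromℕℚ h) →
    inv (prodUpTo (suc (ns fzero)) (λ h → (x - fromℕℚ h) ^ℚ expo r ns h))
    ≡ sumℚ 0 (ns fzero) (λ h → sumℚ 1 m (λ j → a h j * inv ((x - fromℕℚ h) ^ℚ j)))

padeCoeff : ℕ → (ℕ → ℕ → ℚ) → ℕ → Series
padeCoeff n0 a j k =
  inv (fromℕℚ (j !)) * sumℚ 0 n0 (λ h → (a h (suc j) ·ₛ (onePlusZ ^ₛ h)) k)

Rseries : (m n0 : ℕ) → (ℕ → ℕ → ℚ) → Series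
Rseries m n0 a k = sumUpTo m (λ j → (padeCoeff n0 a j *ₛ (log1p ^ₛ j)) k)

logPowers : (m : ℕ) → Fin m → Series
logPowers m j = log1p ^ₛ toℕ j

module Submission where

-- Let θ = (1 + z) d/dz. As θ (1 + z)^h = h (1 + z)^h and θ log^j(1 + z) = j log^(j-1)(1 + z), θ maps a series
-- Σ_{h,j} b h j (1 + z)^h log^j(1 + z)/j! to the series of the same shape with coefficients
-- Θ b h j = h b h j + b h (j + 1), and the constant term of such a series is σ b = Σ_h b h 0. Since θ acts on
-- coefficients by f ↦ (k + 1) f (k + 1) + k f k, the series has order ≥ K as soon as σ (Θ^k b) = 0 for k < K.
-- For x = 1/y one has Σ_{h,j} b h j / (x - h)^(j+1) = Σ_k σ (Θ^k b) y^(k+1), and by the partial fraction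
-- identity this equals y^D / Π_h (1 - h y)^(e h) with D = Σ_h e h = Σ_p (n_p + 1). So σ (Θ^k b) vanishes for
-- k + 1 < D and is 1 for k + 1 = D, which gives the order of R and its nontriviality; the degree bounds come
-- from a h j = 0 for j > e h. Lacking rational functions, every identity between them is proved as an identity
-- of polynomials in y, which suffices to check at infinitely many points.

open import Defs
open import Data.Nat using (ℕ; suc; _≤_; _<_)
open import Data.Fin using (Fin; toℕ; zero) renaming (_<_ to _<ᶠ_)
open import Data.Rational using (ℚ)
open import Relation.Binary.PropositionalEquality using (_≡_)

open import Level using (0ℓ)
import Data.Rational.Properties as ℚₚ
open import Algebra.Properties.Group ℚₚ.+-0-group using (x∙y⁻¹≈ε⇒x≈y)
open import Data.Bool.Base using (true; false; if_then_else_)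
open import Data.Empty using (⊥-elim)
open import Function.Base using (_∘_)
open import Function.Definitions using (Injective)
open import Data.Fin.Base using (fromℕ<)
import Data.Fin.Properties as Finₚ
open import Data.Maybe.Base using (Maybe; just; nothing)
open import Data.Nat.Base as ℕ using (zero; _∸_; _!; _⊔_; _≡ᵇ_; _<ᵇ_; _≤ᵇ_; z≤n; s≤s)
import Data.Nat.Coprimality as Coprime
import Data.Nat.Properties as ℕₚ
open import Data.Nat.Tactic.RingSolver using () renaming (solve-∀ to ℕ-solve-∀)
import Data.Integer.Base as ℤ
import Data.Integer.Properties as ℤₚ
open import Data.Product.Base using (Σ-syntax; _×_; _,_; proj₁; proj₂)
open import Data.Rational.Base using (mkℚ; 0ℚ; 1ℚ; _+_; _*_; _-_; -_; _/_; ↥_)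
open import Relation.Binary.PropositionalEquality
  using (_≢_; refl; sym; trans; cong; cong₂; subst; module ≡-Reasoning)
open import Relation.Nullary using (¬_; yes; no)
open import Relation.Nullary.Decidable using (dec-true; dec-false)
open import Tactic.RingSolver using (solve-∀)
import Tactic.RingSolver.Core.AlmostCommutativeRing as ACR

open ≡-Reasoning

ℚ-ring : ACR.AlmostCommutativeRing 0ℓ 0ℓ
ℚ-ring = ACR.fromCommutativeRing ℚₚ.+-*-commutativeRing 0≟
  where
  0≟ : (x : ℚ) → Maybe (0ℚ ≡ x)
  0≟ x with 0ℚ ℚₚ.≟ x
  ... | yes p = just p
  ... | no _  = nothing

1≢0 : 1ℚ ≢ 0ℚ
1≢0 ()

p-q≡0⇒p≡q : ∀ p q → p - q ≡ 0ℚ → p ≡ q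
p-q≡0⇒p≡q = x∙y⁻¹≈ε⇒x≈y

fromℕℚ-mkℚ : ∀ n → fromℕℚ n ≡ mkℚ (ℤ.+ n) 0 (Coprime.sym (Coprime.1-coprimeTo n))
fromℕℚ-mkℚ n = ℚₚ.normalize-coprime (Coprime.sym (Coprime.1-coprimeTo n))

fromℕℚ-suc : ∀ n → fromℕℚ (suc n) ≡ 1ℚ + fromℕℚ n
fromℕℚ-suc n = sym (begin
  1ℚ + fromℕℚ n                                         ≡⟨ cong (1ℚ +_) (fromℕℚ-mkℚ n) ⟩
  1ℚ + mkℚ (ℤ.+ n) 0 (Coprime.sym (Coprime.1-coprimeTo n)) ≡⟨ cong (λ z → (ℤ.+ 1 ℤ.+ z) / 1) (ℤₚ.*-identityʳ (ℤ.+ n)) ⟩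
  fromℕℚ (suc n)                                        ∎)

fromℕℚ-+ : ∀ a b → fromℕℚ (a ℕ.+ b) ≡ fromℕℚ a + fromℕℚ b
fromℕℚ-+ zero    b = sym (ℚₚ.+-identityˡ (fromℕℚ b))
fromℕℚ-+ (suc a) b = begin
  fromℕℚ (suc (a ℕ.+ b))       ≡⟨ fromℕℚ-suc (a ℕ.+ b) ⟩
  1ℚ + fromℕℚ (a ℕ.+ b)        ≡⟨ cong (1ℚ +_) (fromℕℚ-+ a b) ⟩
  1ℚ + (fromℕℚ a + fromℕℚ b)   ≡⟨ ℚₚ.+-assoc 1ℚ (fromℕℚ a) (fromℕℚ b) ⟨
  (1ℚ + fromℕℚ a) + fromℕℚ b   ≡⟨ cong (_+ fromℕℚ b) (fromℕℚ-suc a) ⟨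
  fromℕℚ (suc a) + fromℕℚ b    ∎

fromℕℚ-* : ∀ a b → fromℕℚ (a ℕ.* b) ≡ fromℕℚ a * fromℕℚ b
fromℕℚ-* zero    b = sym (ℚₚ.*-zeroˡ (fromℕℚ b))
fromℕℚ-* (suc a) b = begin
  fromℕℚ (b ℕ.+ a ℕ.* b)          ≡⟨ fromℕℚ-+ b (a ℕ.* b) ⟩
  fromℕℚ b + fromℕℚ (a ℕ.* b)     ≡⟨ cong (fromℕℚ b +_) (fromℕℚ-* a b) ⟩
  fromℕℚ b + fromℕℚ a * fromℕℚ b  ≡⟨ factor (fromℕℚ a) (fromℕℚ b) ⟩
  (1ℚ + fromℕℚ a) * fromℕℚ b      ≡⟨ cong (_* fromℕℚ b) (fromℕℚ-suc a) ⟨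
  fromℕℚ (suc a) * fromℕℚ b       ∎
  where
  factor : ∀ x y → y + x * y ≡ (1ℚ + x) * y
  factor = solve-∀ ℚ-ring

fromℕℚ-injective : ∀ a b → fromℕℚ a ≡ fromℕℚ b → a ≡ b
fromℕℚ-injective a b eq =
  ℤₚ.+-injective (cong ↥_ (trans (sym (fromℕℚ-mkℚ a)) (trans eq (fromℕℚ-mkℚ b))))

fromℕℚ-suc≢0 : ∀ n → fromℕℚ (suc n) ≢ 0ℚ
fromℕℚ-suc≢0 n eq with trans (sym (fromℕℚ-mkℚ (suc n))) eq
... | ()

inv-inverseˡ : ∀ p → p ≢ 0ℚ → inv p * p ≡ 1ℚ
inv-inverseˡ p@(mkℚ (ℤ.+ zero) _ _) p≢0 = ⊥-elim (p≢0 (ℚₚ.↥p≡0⇒p≡0 p refl))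
inv-inverseˡ p@(mkℚ ℤ.+[1+ _ ] _ _) _   = ℚₚ.*-inverseˡ p
inv-inverseˡ p@(mkℚ ℤ.-[1+ _ ] _ _) _   = ℚₚ.*-inverseˡ p

inv-inverseʳ : ∀ p → p ≢ 0ℚ → p * inv p ≡ 1ℚ
inv-inverseʳ p p≢0 = trans (ℚₚ.*-comm p (inv p)) (inv-inverseˡ p p≢0)

p*q≡0⇒q≡0 : ∀ p q → p ≢ 0ℚ → p * q ≡ 0ℚ → q ≡ 0ℚ
p*q≡0⇒q≡0 p q p≢0 pq≡0 = begin
  q               ≡⟨ ℚₚ.*-identityˡ q ⟨
  1ℚ * q          ≡⟨ cong (_* q) (inv-inverseˡ p p≢0) ⟨
  (inv p * p) * q ≡⟨ ℚₚ.*-assoc (inv p) p q ⟩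
  inv p * (p * q) ≡⟨ cong (inv p *_) pq≡0 ⟩
  inv p * 0ℚ      ≡⟨ ℚₚ.*-zeroʳ (inv p) ⟩
  0ℚ              ∎

*-≢0 : ∀ p q → p ≢ 0ℚ → q ≢ 0ℚ → p * q ≢ 0ℚ
*-≢0 p q p≢0 q≢0 pq≡0 = q≢0 (p*q≡0⇒q≡0 p q p≢0 pq≡0)

*-cancelˡ-≢0 : ∀ p q r → p ≢ 0ℚ → p * q ≡ p * r → q ≡ r
*-cancelˡ-≢0 p q r p≢0 eq = p-q≡0⇒p≡q q r (p*q≡0⇒q≡0 p (q - r) p≢0 (begin
  p * (q - r)     ≡⟨ distrib p q r ⟩
  p * q - p * r   ≡⟨ cong (_- p * r) eq ⟩
  p * r - p * r   ≡⟨ ℚₚ.+-inverseʳ (p * r) ⟩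
  0ℚ              ∎))
  where
  distrib : ∀ p q r → p * (q - r) ≡ p * q - p * r
  distrib = solve-∀ ℚ-ring

inv-unique : ∀ p q → p ≢ 0ℚ → p * q ≡ 1ℚ → inv p ≡ q
inv-unique p q p≢0 pq≡1 = *-cancelˡ-≢0 p (inv p) q p≢0 (trans (inv-inverseʳ p p≢0) (sym pq≡1))

inv-≢0 : ∀ p → p ≢ 0ℚ → inv p ≢ 0ℚ
inv-≢0 p p≢0 inv≡0 = 1≢0 (begin
  1ℚ          ≡⟨ inv-inverseˡ p p≢0 ⟨
  inv p * p   ≡⟨ cong (_* p) inv≡0 ⟩
  0ℚ * p      ≡⟨ ℚₚ.*-zeroˡ p ⟩
  0ℚ          ∎)

inv-involutive : ∀ p → inv (inv p) ≡ p
inv-involutive p with p ℚₚ.≟ 0ℚ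
... | yes refl = refl
... | no p≢0   = inv-unique (inv p) p (inv-≢0 p p≢0) (inv-inverseˡ p p≢0)

inv-distrib-* : ∀ p q → inv (p * q) ≡ inv p * inv q
inv-distrib-* p q with p ℚₚ.≟ 0ℚ | q ℚₚ.≟ 0ℚ
... | yes refl | _        = trans (cong inv (ℚₚ.*-zeroˡ q)) (sym (ℚₚ.*-zeroˡ (inv q)))
... | no _     | yes refl = trans (cong inv (ℚₚ.*-zeroʳ p)) (sym (ℚₚ.*-zeroʳ (inv p)))
... | no p≢0   | no q≢0   = inv-unique (p * q) (inv p * inv q) (*-≢0 p q p≢0 q≢0) (begin
  p * q * (inv p * inv q)     ≡⟨ shuffle p q (inv p) (inv q) ⟩
  (p * inv p) * (q * inv q)   ≡⟨ cong₂ _*_ (inv-inverseʳ p p≢0) (inv-inverseʳ q q≢0) ⟩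
  1ℚ                          ∎)
  where
  shuffle : ∀ a b c d → a * b * (c * d) ≡ (a * c) * (b * d)
  shuffle = solve-∀ ℚ-ring

^-distribˡ-+-* : ∀ q a b → q ^ℚ (a ℕ.+ b) ≡ q ^ℚ a * q ^ℚ b
^-distribˡ-+-* q zero    b = sym (ℚₚ.*-identityˡ (q ^ℚ b))
^-distribˡ-+-* q (suc a) b = trans (cong (q *_) (^-distribˡ-+-* q a b)) (sym (ℚₚ.*-assoc q _ _))

^-distribʳ-* : ∀ p q a → (p * q) ^ℚ a ≡ p ^ℚ a * q ^ℚ a
^-distribʳ-* p q zero    = refl
^-distribʳ-* p q (suc a) = trans (cong ((p * q) *_) (^-distribʳ-* p q a)) (shuffle p q (p ^ℚ a) (q ^ℚ a))
  where
  shuffle : ∀ a b c d → a * b * (c * d) ≡ (a * c) * (b * d)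
  shuffle = solve-∀ ℚ-ring

1^n≡1 : ∀ n → 1ℚ ^ℚ n ≡ 1ℚ
1^n≡1 zero    = refl
1^n≡1 (suc n) = trans (ℚₚ.*-identityˡ (1ℚ ^ℚ n)) (1^n≡1 n)

0^suc≡0 : ∀ n → 0ℚ ^ℚ suc n ≡ 0ℚ
0^suc≡0 n = ℚₚ.*-zeroˡ (0ℚ ^ℚ n)

^-≢0 : ∀ q n → q ≢ 0ℚ → q ^ℚ n ≢ 0ℚ
^-≢0 q zero    _   = 1≢0
^-≢0 q (suc n) q≢0 = *-≢0 q _ q≢0 (^-≢0 q n q≢0)

inv-distrib-^ : ∀ q n → inv (q ^ℚ n) ≡ inv q ^ℚ n
inv-distrib-^ q zero    = refl
inv-distrib-^ q (suc n) = trans (inv-distrib-* q _) (cong (inv q *_) (inv-distrib-^ q n))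

sum-cong< : ∀ N {f g} → (∀ i → i < N → f i ≡ g i) → sumUpTo N f ≡ sumUpTo N g
sum-cong< zero    eq = refl
sum-cong< (suc N) eq = cong₂ _+_ (sum-cong< N (λ i i<N → eq i (ℕₚ.m<n⇒m<1+n i<N))) (eq N (ℕₚ.n<1+n N))

sum-cong : ∀ N {f g} → (∀ i → f i ≡ g i) → sumUpTo N f ≡ sumUpTo N g
sum-cong N eq = sum-cong< N (λ i _ → eq i)

sum-zero : ∀ N {f} → (∀ i → i < N → f i ≡ 0ℚ) → sumUpTo N f ≡ 0ℚ
sum-zero N eq = trans (sum-cong< N eq) (zeros N)
  where
  zeros : ∀ N → sumUpTo N (λ _ → 0ℚ) ≡ 0ℚ
  zeros zero    = refl
  zeros (suc N) = cong (_+ 0ℚ) (zeros N)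

sum-distrib-+ : ∀ N f g → sumUpTo N (λ i → f i + g i) ≡ sumUpTo N f + sumUpTo N g
sum-distrib-+ zero    f g = refl
sum-distrib-+ (suc N) f g =
  trans (cong (_+ (f N + g N)) (sum-distrib-+ N f g)) (shuffle (sumUpTo N f) (sumUpTo N g) (f N) (g N))
  where
  shuffle : ∀ a b c d → a + b + (c + d) ≡ a + c + (b + d)
  shuffle = solve-∀ ℚ-ring

sum-distribˡ-* : ∀ N c f → c * sumUpTo N f ≡ sumUpTo N (λ i → c * f i)
sum-distribˡ-* zero    c f = ℚₚ.*-zeroʳ c
sum-distribˡ-* (suc N) c f =
  trans (ℚₚ.*-distribˡ-+ c (sumUpTo N f) (f N)) (cong (_+ c * f N) (sum-distribˡ-* N c f))

sum-distribʳ-* : ∀ N c f → sumUpTo N f * c ≡ sumUpTo N (λ i → f i * c)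
sum-distribʳ-* N c f = trans (ℚₚ.*-comm (sumUpTo N f) c)
  (trans (sum-distribˡ-* N c f) (sum-cong N (λ i → ℚₚ.*-comm c (f i))))

sum-suc-head : ∀ N f → sumUpTo (suc N) f ≡ f 0 + sumUpTo N (λ i → f (suc i))
sum-suc-head zero    f = trans (ℚₚ.+-identityˡ (f 0)) (sym (ℚₚ.+-identityʳ (f 0)))
sum-suc-head (suc N) f = trans (cong (_+ f (suc N)) (sum-suc-head N f)) (ℚₚ.+-assoc (f 0) _ (f (suc N)))

sumFinℚ≡sumUpTo : ∀ m (f : ℕ → ℚ) → sumFinℚ {m} (λ j → f (toℕ j)) ≡ sumUpTo m f
sumFinℚ≡sumUpTo zero    f = refl
sumFinℚ≡sumUpTo (suc m) f = trans (cong (f 0 +_) (sumFinℚ≡sumUpTo m (λ i → f (suc i)))) (sym (sum-suc-head m f))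

prod-cong< : ∀ N {f g} → (∀ i → i < N → f i ≡ g i) → prodUpTo N f ≡ prodUpTo N g
prod-cong< zero    eq = refl
prod-cong< (suc N) eq = cong₂ _*_ (prod-cong< N (λ i i<N → eq i (ℕₚ.m<n⇒m<1+n i<N))) (eq N (ℕₚ.n<1+n N))

prod-one : ∀ N {f} → (∀ i → i < N → f i ≡ 1ℚ) → prodUpTo N f ≡ 1ℚ
prod-one N eq = trans (prod-cong< N eq) (ones N)
  where
  ones : ∀ N → prodUpTo N (λ _ → 1ℚ) ≡ 1ℚ
  ones zero    = refl
  ones (suc N) = cong (_* 1ℚ) (ones N)

prod-distrib-* : ∀ N f g → prodUpTo N (λ i → f i * g i) ≡ prodUpTo N f * prodUpTo N g
prod-distrib-* zero    f g = refl
prod-distrib-* (suc N) f g =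
  trans (cong (_* (f N * g N)) (prod-distrib-* N f g)) (shuffle (prodUpTo N f) (prodUpTo N g) (f N) (g N))
  where
  shuffle : ∀ a b c d → a * b * (c * d) ≡ a * c * (b * d)
  shuffle = solve-∀ ℚ-ring

sumℕ : ℕ → (ℕ → ℕ) → ℕ
sumℕ zero    f = 0
sumℕ (suc N) f = sumℕ N f ℕ.+ f N

prod-^ : ∀ N q e → prodUpTo N (λ i → q ^ℚ e i) ≡ q ^ℚ sumℕ N e
prod-^ zero    q e = refl
prod-^ (suc N) q e = trans (cong (_* q ^ℚ e N) (prod-^ N q e)) (sym (^-distribˡ-+-* q (sumℕ N e) (e N)))

prod-≢0 : ∀ N f → (∀ i → i < N → f i ≢ 0ℚ) → prodUpTo N f ≢ 0ℚ
prod-≢0 zero    f _   = 1≢0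
prod-≢0 (suc N) f f≢0 =
  *-≢0 _ _ (prod-≢0 N f (λ i i<N → f≢0 i (ℕₚ.m<n⇒m<1+n i<N))) (f≢0 N (ℕₚ.n<1+n N))

inv-distrib-prod : ∀ N f → inv (prodUpTo N f) ≡ prodUpTo N (λ i → inv (f i))
inv-distrib-prod zero    f = refl
inv-distrib-prod (suc N) f = trans (inv-distrib-* (prodUpTo N f) (f N)) (cong (_* inv (f N)) (inv-distrib-prod N f))

update : (ℕ → ℚ) → ℕ → ℚ → ℕ → ℚ
update f h c i = if i ≡ᵇ h then c else f i

update-≢ : ∀ f h c i → i ≢ h → update f h c i ≡ f i
update-≢ f h c i i≢h rewrite dec-false (i ℕₚ.≟ h) i≢h = refl

update-≡ : ∀ f h c → update f h c h ≡ c
update-≡ f h c rewrite dec-true (h ℕₚ.≟ h) refl = refl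

sum-remove : ∀ N f h → h < N → sumUpTo N f ≡ f h + sumUpTo N (update f h 0ℚ)
sum-remove (suc N) f h h<1+N with h ℕₚ.≟ N
... | yes refl = begin
  sumUpTo h f + f h                          ≡⟨ cong (_+ f h) (sum-cong< h (λ i i<h → sym (update-≢ f h 0ℚ i (ℕₚ.<⇒≢ i<h)))) ⟩
  sumUpTo h (update f h 0ℚ) + f h            ≡⟨ swap (sumUpTo h (update f h 0ℚ)) (f h) ⟩
  f h + (sumUpTo h (update f h 0ℚ) + 0ℚ)     ≡⟨ cong (λ z → f h + (sumUpTo h (update f h 0ℚ) + z)) (update-≡ f h 0ℚ) ⟨
  f h + sumUpTo (suc h) (update f h 0ℚ)      ∎
  where
  swap : ∀ a b → a + b ≡ b + (a + 0ℚ)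
  swap = solve-∀ ℚ-ring
... | no h≢N = begin
  sumUpTo N f + f N                               ≡⟨ cong (_+ f N) (sum-remove N f h h<N) ⟩
  (f h + sumUpTo N (update f h 0ℚ)) + f N         ≡⟨ ℚₚ.+-assoc (f h) _ (f N) ⟩
  f h + (sumUpTo N (update f h 0ℚ) + f N)         ≡⟨ cong (λ z → f h + (sumUpTo N (update f h 0ℚ) + z)) (update-≢ f h 0ℚ N (h≢N ∘ sym)) ⟨
  f h + sumUpTo (suc N) (update f h 0ℚ)           ∎
  where
  h<N : h < N
  h<N = ℕₚ.≤∧≢⇒< (ℕₚ.≤-pred h<1+N) h≢N

prod-remove : ∀ N f h → h < N → f h * prodUpTo N (update f h 1ℚ) ≡ prodUpTo N f
prod-remove (suc N) f h h<1+N with h ℕₚ.≟ N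
... | yes refl = begin
  f h * (prodUpTo h (update f h 1ℚ) * update f h 1ℚ h) ≡⟨ cong (λ z → f h * (prodUpTo h (update f h 1ℚ) * z)) (update-≡ f h 1ℚ) ⟩
  f h * (prodUpTo h (update f h 1ℚ) * 1ℚ)             ≡⟨ swap (f h) (prodUpTo h (update f h 1ℚ)) ⟩
  prodUpTo h (update f h 1ℚ) * f h                    ≡⟨ cong (_* f h) (prod-cong< h (λ i i<h → update-≢ f h 1ℚ i (ℕₚ.<⇒≢ i<h))) ⟩
  prodUpTo h f * f h                                  ∎
  where
  swap : ∀ a b → a * (b * 1ℚ) ≡ b * a
  swap = solve-∀ ℚ-ring
... | no h≢N = begin
  f h * (prodUpTo N (update f h 1ℚ) * update f h 1ℚ N) ≡⟨ cong (λ z → f h * (prodUpTo N (update f h 1ℚ) * z)) (update-≢ f h 1ℚ N (h≢N ∘ sym)) ⟩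
  f h * (prodUpTo N (update f h 1ℚ) * f N)            ≡⟨ ℚₚ.*-assoc (f h) _ (f N) ⟨
  (f h * prodUpTo N (update f h 1ℚ)) * f N            ≡⟨ cong (_* f N) (prod-remove N f h (ℕₚ.≤∧≢⇒< (ℕₚ.≤-pred h<1+N) h≢N)) ⟩
  prodUpTo N f * f N                                  ∎

-- Polynomial functions ℚ → ℚ

data Poly : ℕ → (ℚ → ℚ) → Set where
  const  : (c : ℚ) → Poly 0 (λ _ → c)
  linear : ∀ {d g} (c : ℚ) → Poly d g → Poly (suc d) (λ x → (x - c) * g x)
  plus   : ∀ {d f g} → Poly d f → Poly d g → Poly d (λ x → f x + g x)
  raise  : ∀ {d g} → Poly d g → Poly (suc d) g
  ext    : ∀ {d f g} → Poly d f → (∀ x → f x ≡ g x) → Poly d g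

IsPoly : (ℚ → ℚ) → Set
IsPoly f = Σ[ d ∈ ℕ ] Poly d f

Poly-≤ : ∀ {d g} d′ → d ≤ d′ → Poly d g → Poly d′ g
Poly-≤ {d} d′ d≤d′ p = subst (λ e → Poly e _) (ℕₚ.m∸n+n≡m d≤d′) (raises (d′ ∸ d) p)
  where
  raises : ∀ {d g} e → Poly d g → Poly (e ℕ.+ d) g
  raises zero    p = p
  raises (suc e) p = raise (raises e p)

Poly-scale : ∀ {d g} c → Poly d g → Poly d (λ x → c * g x)
Poly-scale c (const c′)               = const (c * c′)
Poly-scale c (linear {g = g} c′ p)    = ext (linear c′ (Poly-scale c p)) (λ x → swap c (x - c′) (g x))
  where
  swap : ∀ a b d → b * (a * d) ≡ a * (b * d)
  swap = solve-∀ ℚ-ring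
Poly-scale c (plus {f = f} {g = g} p q) =
  ext (plus (Poly-scale c p) (Poly-scale c q)) (λ x → sym (ℚₚ.*-distribˡ-+ c (f x) (g x)))
Poly-scale c (raise p)                = raise (Poly-scale c p)
Poly-scale c (ext p eq)               = ext (Poly-scale c p) (λ x → cong (c *_) (eq x))

Poly-* : ∀ {d e f g} → Poly d f → Poly e g → Poly (d ℕ.+ e) (λ x → f x * g x)
Poly-* (const c)                         q = Poly-scale c q
Poly-* {g = g} (linear {g = f} c p)      q = ext (linear c (Poly-* p q)) (λ x → sym (ℚₚ.*-assoc (x - c) (f x) (g x)))
Poly-* {g = g} (plus {f = f₁} {g = f₂} p p′) q =
  ext (plus (Poly-* p q) (Poly-* p′ q)) (λ x → sym (ℚₚ.*-distribʳ-+ (g x) (f₁ x) (f₂ x)))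
Poly-* (raise p)                         q = raise (Poly-* p q)
Poly-* {g = g} (ext p eq)                q = ext (Poly-* p q) (λ x → cong (_* g x) (eq x))

poly-const : ∀ c → IsPoly (λ _ → c)
poly-const c = 0 , const c

poly-id : IsPoly (λ x → x)
poly-id = 1 , ext (linear 0ℚ (const 1ℚ)) identity
  where
  identity : ∀ x → (x - 0ℚ) * 1ℚ ≡ x
  identity = solve-∀ ℚ-ring

poly-+ : ∀ {f g} → IsPoly f → IsPoly g → IsPoly (λ x → f x + g x)
poly-+ (d , p) (e , q) = d ⊔ e , plus (Poly-≤ (d ⊔ e) (ℕₚ.m≤m⊔n d e) p) (Poly-≤ (d ⊔ e) (ℕₚ.m≤n⊔m d e) q)

poly-* : ∀ {f g} → IsPoly f → IsPoly g → IsPoly (λ x → f x * g x)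
poly-* (d , p) (e , q) = d ℕ.+ e , Poly-* p q

poly-scale : ∀ {g} c → IsPoly g → IsPoly (λ x → c * g x)
poly-scale c (d , p) = d , Poly-scale c p

poly-sub : ∀ {f g} → IsPoly f → IsPoly g → IsPoly (λ x → f x - g x)
poly-sub {g = g} pf (d , q) = poly-+ pf (d , ext (Poly-scale (- 1ℚ) q) (λ x → neg (g x)))
  where
  neg : ∀ y → - 1ℚ * y ≡ - y
  neg = solve-∀ ℚ-ring

poly-^ : ∀ {g} n → IsPoly g → IsPoly (λ x → g x ^ℚ n)
poly-^ zero    p = poly-const 1ℚ
poly-^ (suc n) p = poly-* p (poly-^ n p)

poly-sum : ∀ N (F : ℕ → ℚ → ℚ) → (∀ i → i < N → IsPoly (F i)) → IsPoly (λ x → sumUpTo N (λ i → F i x))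
poly-sum zero    F p = poly-const 0ℚ
poly-sum (suc N) F p = poly-+ (poly-sum N F (λ i i<N → p i (ℕₚ.m<n⇒m<1+n i<N))) (p N (ℕₚ.n<1+n N))

poly-prod : ∀ N (F : ℕ → ℚ → ℚ) → (∀ i → i < N → IsPoly (F i)) → IsPoly (λ x → prodUpTo N (λ i → F i x))
poly-prod zero    F p = poly-const 1ℚ
poly-prod (suc N) F p = poly-* (poly-prod N F (λ i i<N → p i (ℕₚ.m<n⇒m<1+n i<N))) (p N (ℕₚ.n<1+n N))

Poly-pred : ∀ {g} d → Poly (ℕ.pred d) g → Poly d g
Poly-pred zero    p = p
Poly-pred (suc d) p = raise p

factor-theorem : ∀ {d g} → Poly d g → ∀ c →
  Σ[ q ∈ (ℚ → ℚ) ] Poly (ℕ.pred d) q × (∀ x → g x ≡ g c + (x - c) * q x)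
factor-theorem (const c′) c = (λ _ → 0ℚ) , const 0ℚ , (λ x → pad c′ (x - c))
  where
  pad : ∀ a b → a ≡ a + b * 0ℚ
  pad = solve-∀ ℚ-ring
factor-theorem {suc d} (linear {g = g} c′ p) c with factor-theorem p c
... | q , pq , eq = (λ x → g x + (c - c′) * q x) , plus p (Poly-scale (c - c′) (Poly-pred d pq)) , expand
  where
  regroup : ∀ x c c′ a b → (x - c′) * (a + (x - c) * b) ≡ (c - c′) * a + (x - c) * ((a + (x - c) * b) + (c - c′) * b)
  regroup = solve-∀ ℚ-ring
  expand : ∀ x → (x - c′) * g x ≡ (c - c′) * g c + (x - c) * (g x + (c - c′) * q x)
  expand x = begin
    (x - c′) * g x                                               ≡⟨ cong ((x - c′) *_) (eq x) ⟩
    (x - c′) * (g c + (x - c) * q x)                             ≡⟨ regroup x c c′ (g c) (q x) ⟩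
    (c - c′) * g c + (x - c) * ((g c + (x - c) * q x) + (c - c′) * q x)
      ≡⟨ cong (λ z → (c - c′) * g c + (x - c) * (z + (c - c′) * q x)) (eq x) ⟨
    (c - c′) * g c + (x - c) * (g x + (c - c′) * q x)            ∎
factor-theorem (plus {f = f} {g = g} p p′) c with factor-theorem p c | factor-theorem p′ c
... | q , pq , eq | q′ , pq′ , eq′ =
  (λ x → q x + q′ x) , plus pq pq′ ,
  (λ x → trans (cong₂ _+_ (eq x) (eq′ x)) (regroup (f c) (g c) (x - c) (q x) (q′ x)))
  where
  regroup : ∀ a b y u v → (a + y * u) + (b + y * v) ≡ (a + b) + y * (u + v)
  regroup = solve-∀ ℚ-ring
factor-theorem {suc d} (raise p) c with factor-theorem p c
... | q , pq , eq = q , Poly-pred d pq , eq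
factor-theorem (ext {f = f} {g = g} p f≗g) c with factor-theorem p c
... | q , pq , eq = q , pq , (λ x → trans (sym (f≗g x)) (trans (eq x) (cong (_+ (x - c) * q x) (f≗g c))))

Poly-0-constant : ∀ {g} → Poly 0 g → ∀ x y → g x ≡ g y
Poly-0-constant (const c)  x y = refl
Poly-0-constant (plus p q) x y = cong₂ _+_ (Poly-0-constant p x y) (Poly-0-constant q x y)
Poly-0-constant (ext p eq) x y = trans (sym (eq x)) (trans (Poly-0-constant p x y) (eq y))

Poly-zero : ∀ d {g} → Poly d g → (pt : ℕ → ℚ) → Injective _≡_ _≡_ pt → (∀ i → g (pt i) ≡ 0ℚ) → ∀ x → g x ≡ 0ℚ
Poly-zero zero    p pt _     g≡0 x = trans (Poly-0-constant p x (pt 0)) (g≡0 0)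
Poly-zero (suc d) {g} p pt inj g≡0 x with factor-theorem p (pt 0)
... | q , pq , eq = begin
  g x                       ≡⟨ eq x ⟩
  g (pt 0) + (x - pt 0) * q x ≡⟨ cong₂ (λ a b → a + (x - pt 0) * b) (g≡0 0) (Poly-zero d pq (pt ∘ suc) (ℕₚ.suc-injective ∘ inj) q≡0 x) ⟩
  0ℚ + (x - pt 0) * 0ℚ      ≡⟨ vanish (x - pt 0) ⟩
  0ℚ                        ∎
  where
  vanish : ∀ y → 0ℚ + y * 0ℚ ≡ 0ℚ
  vanish = solve-∀ ℚ-ring
  pt≢pt0 : ∀ i → pt (suc i) - pt 0 ≢ 0ℚ
  pt≢pt0 i eq₀ with inj (p-q≡0⇒p≡q (pt (suc i)) (pt 0) eq₀)
  ... | ()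
  q≡0 : ∀ i → q (pt (suc i)) ≡ 0ℚ
  q≡0 i = p*q≡0⇒q≡0 (pt (suc i) - pt 0) _ (pt≢pt0 i) (begin
    (pt (suc i) - pt 0) * q (pt (suc i))              ≡⟨ ℚₚ.+-identityˡ _ ⟨
    0ℚ + (pt (suc i) - pt 0) * q (pt (suc i))         ≡⟨ cong (_+ (pt (suc i) - pt 0) * q (pt (suc i))) (g≡0 0) ⟨
    g (pt 0) + (pt (suc i) - pt 0) * q (pt (suc i))   ≡⟨ eq (pt (suc i)) ⟨
    g (pt (suc i))                                    ≡⟨ g≡0 (suc i) ⟩
    0ℚ                                                ∎)

poly-ext : ∀ {f g} → IsPoly f → IsPoly g → (pt : ℕ → ℚ) → Injective _≡_ _≡_ pt →
           (∀ i → f (pt i) ≡ g (pt i)) → ∀ x → f x ≡ g x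
poly-ext {f} {g} pf pg pt inj f≡g x with poly-sub pf pg
... | d , p = p-q≡0⇒p≡q (f x) (g x) (Poly-zero d p pt inj (λ i → trans (cong (λ z → f (pt i) - z) (sym (f≡g i))) (ℚₚ.+-inverseʳ (f (pt i)))) x)

-- Formal power series and the derivation θ = (1 + z) d/dz

infix 4 _≈ₛ_
_≈ₛ_ : Series → Series → Set
f ≈ₛ g = ∀ k → f k ≡ g k

0ₛ : Series
0ₛ _ = 0ℚ

*ₛ-congˡ : ∀ {f f′} g → f ≈ₛ f′ → (f *ₛ g) ≈ₛ (f′ *ₛ g)
*ₛ-congˡ g f≈f′ k = sum-cong (suc k) (λ i → cong (_* g (k ∸ i)) (f≈f′ i))

*ₛ-congʳ : ∀ f {g g′} → g ≈ₛ g′ → (f *ₛ g) ≈ₛ (f *ₛ g′)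
*ₛ-congʳ f g≈g′ k = sum-cong (suc k) (λ i → cong (f i *_) (g≈g′ (k ∸ i)))

*ₛ-distribʳ-+ₛ : ∀ f f′ g → ((f +ₛ f′) *ₛ g) ≈ₛ ((f *ₛ g) +ₛ (f′ *ₛ g))
*ₛ-distribʳ-+ₛ f f′ g k =
  trans (sum-cong (suc k) (λ i → ℚₚ.*-distribʳ-+ (g (k ∸ i)) (f i) (f′ i))) (sum-distrib-+ (suc k) _ _)

*ₛ-distribˡ-+ₛ : ∀ f g g′ → (f *ₛ (g +ₛ g′)) ≈ₛ ((f *ₛ g) +ₛ (f *ₛ g′))
*ₛ-distribˡ-+ₛ f g g′ k =
  trans (sum-cong (suc k) (λ i → ℚₚ.*-distribˡ-+ (f i) (g (k ∸ i)) (g′ (k ∸ i)))) (sum-distrib-+ (suc k) _ _)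

*ₛ-·ₛˡ : ∀ c f g → ((c ·ₛ f) *ₛ g) ≈ₛ (c ·ₛ (f *ₛ g))
*ₛ-·ₛˡ c f g k = trans (sum-cong (suc k) (λ i → ℚₚ.*-assoc c (f i) (g (k ∸ i)))) (sym (sum-distribˡ-* (suc k) c _))

*ₛ-·ₛʳ : ∀ c f g → (f *ₛ (c ·ₛ g)) ≈ₛ (c ·ₛ (f *ₛ g))
*ₛ-·ₛʳ c f g k = trans (sum-cong (suc k) (λ i → swap (f i) c (g (k ∸ i)))) (sym (sum-distribˡ-* (suc k) c _))
  where
  swap : ∀ a b d → a * (b * d) ≡ b * (a * d)
  swap = solve-∀ ℚ-ring

*ₛ-zeroˡ : ∀ f → (0ₛ *ₛ f) ≈ₛ 0ₛ
*ₛ-zeroˡ f k = sum-zero (suc k) (λ i _ → ℚₚ.*-zeroˡ (f (k ∸ i)))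

*ₛ-zeroʳ : ∀ f → (f *ₛ 0ₛ) ≈ₛ 0ₛ
*ₛ-zeroʳ f k = sum-zero (suc k) (λ i _ → ℚₚ.*-zeroʳ (f i))

*ₛ-identityˡ : ∀ f → (oneₛ *ₛ f) ≈ₛ f
*ₛ-identityˡ f k = begin
  sumUpTo (suc k) (λ i → oneₛ i * f (k ∸ i))              ≡⟨ sum-suc-head k _ ⟩
  1ℚ * f k + sumUpTo k (λ i → 0ℚ * f (k ∸ suc i))         ≡⟨ cong₂ _+_ (ℚₚ.*-identityˡ (f k)) (sum-zero k (λ i _ → ℚₚ.*-zeroˡ (f (k ∸ suc i)))) ⟩
  f k + 0ℚ                                                ≡⟨ ℚₚ.+-identityʳ (f k) ⟩
  f k                                                     ∎

deriv : Series → Series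
deriv f k = fromℕℚ (suc k) * f (suc k)

zDeriv : Series → Series
zDeriv f k = fromℕℚ k * f k

θ : Series → Series
θ f k = deriv f k + zDeriv f k

private
  n*xy-split : ∀ n i (x y : ℚ) → i ≤ n → fromℕℚ n * (x * y) ≡ (fromℕℚ i * x) * y + x * (fromℕℚ (n ∸ i) * y)
  n*xy-split n i x y i≤n = begin
    fromℕℚ n * (x * y)                      ≡⟨ cong (λ z → fromℕℚ z * (x * y)) (ℕₚ.m+[n∸m]≡n i≤n) ⟨
    fromℕℚ (i ℕ.+ (n ∸ i)) * (x * y)        ≡⟨ cong (_* (x * y)) (fromℕℚ-+ i (n ∸ i)) ⟩
    (fromℕℚ i + fromℕℚ (n ∸ i)) * (x * y)   ≡⟨ expand (fromℕℚ i) (fromℕℚ (n ∸ i)) x y ⟩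
    (fromℕℚ i * x) * y + x * (fromℕℚ (n ∸ i) * y) ∎
    where
    expand : ∀ a b c d → (a + b) * (c * d) ≡ (a * c) * d + c * (b * d)
    expand = solve-∀ ℚ-ring

  -- Coefficient n of a product is a sum over i + (n ∸ i) = n, so n splits as i + (n ∸ i) in every term.
  weighted-Leibniz : ∀ n f g → fromℕℚ n * (f *ₛ g) n ≡ (zDeriv f *ₛ g) n + (f *ₛ zDeriv g) n
  weighted-Leibniz n f g = begin
    fromℕℚ n * sumUpTo (suc n) (λ i → f i * g (n ∸ i))                 ≡⟨ sum-distribˡ-* (suc n) (fromℕℚ n) _ ⟩
    sumUpTo (suc n) (λ i → fromℕℚ n * (f i * g (n ∸ i)))               ≡⟨ sum-cong< (suc n) (λ i i<1+n → n*xy-split n i (f i) (g (n ∸ i)) (ℕₚ.≤-pred i<1+n)) ⟩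
    sumUpTo (suc n) (λ i → zDeriv f i * g (n ∸ i) + f i * zDeriv g (n ∸ i)) ≡⟨ sum-distrib-+ (suc n) _ _ ⟩
    (zDeriv f *ₛ g) n + (f *ₛ zDeriv g) n                              ∎

zDeriv-Leibniz : ∀ f g → zDeriv (f *ₛ g) ≈ₛ ((zDeriv f *ₛ g) +ₛ (f *ₛ zDeriv g))
zDeriv-Leibniz f g k = weighted-Leibniz k f g

deriv-Leibniz : ∀ f g → deriv (f *ₛ g) ≈ₛ ((deriv f *ₛ g) +ₛ (f *ₛ deriv g))
deriv-Leibniz f g k = begin
  fromℕℚ (suc k) * (f *ₛ g) (suc k)                    ≡⟨ weighted-Leibniz (suc k) f g ⟩
  (zDeriv f *ₛ g) (suc k) + (f *ₛ zDeriv g) (suc k)    ≡⟨ cong₂ _+_ first second ⟩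
  (deriv f *ₛ g) k + (f *ₛ deriv g) k                  ∎
  where
  first : (zDeriv f *ₛ g) (suc k) ≡ (deriv f *ₛ g) k
  first = begin
    sumUpTo (suc (suc k)) (λ i → zDeriv f i * g (suc k ∸ i))           ≡⟨ sum-suc-head (suc k) _ ⟩
    (0ℚ * f 0) * g (suc k) + (deriv f *ₛ g) k                          ≡⟨ cong (_+ (deriv f *ₛ g) k) (trans (cong (_* g (suc k)) (ℚₚ.*-zeroˡ (f 0))) (ℚₚ.*-zeroˡ (g (suc k)))) ⟩
    0ℚ + (deriv f *ₛ g) k                                              ≡⟨ ℚₚ.+-identityˡ _ ⟩
    (deriv f *ₛ g) k                                                   ∎
  last-term : f (suc k) * zDeriv g (suc k ∸ suc k) ≡ 0ℚ
  last-term = begin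
    f (suc k) * (fromℕℚ (suc k ∸ suc k) * g (suc k ∸ suc k)) ≡⟨ cong (λ z → f (suc k) * (fromℕℚ z * g z)) (ℕₚ.n∸n≡0 (suc k)) ⟩
    f (suc k) * (0ℚ * g 0)                                   ≡⟨ cong (f (suc k) *_) (ℚₚ.*-zeroˡ (g 0)) ⟩
    f (suc k) * 0ℚ                                           ≡⟨ ℚₚ.*-zeroʳ (f (suc k)) ⟩
    0ℚ                                                       ∎
  second : (f *ₛ zDeriv g) (suc k) ≡ (f *ₛ deriv g) k
  second = begin
    sumUpTo (suc k) (λ i → f i * zDeriv g (suc k ∸ i)) + f (suc k) * zDeriv g (suc k ∸ suc k)
      ≡⟨ cong₂ _+_ (sum-cong< (suc k) (λ i i<1+k → cong (λ z → f i * (fromℕℚ z * g z)) (ℕₚ.+-∸-assoc 1 (ℕₚ.≤-pred i<1+k)))) last-term ⟩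
    (f *ₛ deriv g) k + 0ℚ ≡⟨ ℚₚ.+-identityʳ _ ⟩
    (f *ₛ deriv g) k      ∎

θ-Leibniz : ∀ f g → θ (f *ₛ g) ≈ₛ ((θ f *ₛ g) +ₛ (f *ₛ θ g))
θ-Leibniz f g k = begin
  deriv (f *ₛ g) k + zDeriv (f *ₛ g) k
    ≡⟨ cong₂ _+_ (deriv-Leibniz f g k) (zDeriv-Leibniz f g k) ⟩
  ((deriv f *ₛ g) k + (f *ₛ deriv g) k) + ((zDeriv f *ₛ g) k + (f *ₛ zDeriv g) k)
    ≡⟨ shuffle ((deriv f *ₛ g) k) ((f *ₛ deriv g) k) ((zDeriv f *ₛ g) k) ((f *ₛ zDeriv g) k) ⟩
  ((deriv f *ₛ g) k + (zDeriv f *ₛ g) k) + ((f *ₛ deriv g) k + (f *ₛ zDeriv g) k)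
    ≡⟨ cong₂ _+_ (*ₛ-distribʳ-+ₛ (deriv f) (zDeriv f) g k) (*ₛ-distribˡ-+ₛ f (deriv g) (zDeriv g) k) ⟨
  (θ f *ₛ g) k + (f *ₛ θ g) k ∎
  where
  shuffle : ∀ a b c d → (a + b) + (c + d) ≡ (a + c) + (b + d)
  shuffle = solve-∀ ℚ-ring

θ-cong : ∀ {f g} → f ≈ₛ g → θ f ≈ₛ θ g
θ-cong f≈g k = cong₂ _+_ (cong (fromℕℚ (suc k) *_) (f≈g (suc k))) (cong (fromℕℚ k *_) (f≈g k))

θ-zero : θ 0ₛ ≈ₛ 0ₛ
θ-zero k = trans (cong₂ _+_ (ℚₚ.*-zeroʳ (fromℕℚ (suc k))) (ℚₚ.*-zeroʳ (fromℕℚ k))) (ℚₚ.+-identityˡ 0ℚ)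

θ-sum : ∀ N (F : ℕ → Series) → θ (λ k → sumUpTo N (λ j → F j k)) ≈ₛ (λ k → sumUpTo N (λ j → θ (F j) k))
θ-sum N F k = begin
  fromℕℚ (suc k) * sumUpTo N (λ j → F j (suc k)) + fromℕℚ k * sumUpTo N (λ j → F j k)
    ≡⟨ cong₂ _+_ (sum-distribˡ-* N (fromℕℚ (suc k)) _) (sum-distribˡ-* N (fromℕℚ k) _) ⟩
  sumUpTo N (λ j → deriv (F j) k) + sumUpTo N (λ j → zDeriv (F j) k)
    ≡⟨ sum-distrib-+ N _ _ ⟨
  sumUpTo N (λ j → θ (F j) k) ∎

θ-one : θ oneₛ ≈ₛ 0ₛ
θ-one zero    = refl
θ-one (suc k) = θ-zero (suc k)

θ-onePlusZ : θ onePlusZ ≈ₛ onePlusZ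
θ-onePlusZ zero          = refl
θ-onePlusZ (suc zero)    = refl
θ-onePlusZ (suc (suc k)) = θ-zero (suc (suc k))

θ-log1p : θ log1p ≈ₛ oneₛ
θ-log1p zero    = refl
θ-log1p (suc k) = begin
  fromℕℚ (2 ℕ.+ k) * (s′ * (ℤ.+ 1 / (2 ℕ.+ k))) + fromℕℚ (suc k) * (s * (ℤ.+ 1 / suc k))
    ≡⟨ cong₂ _+_ (cong (fromℕℚ (2 ℕ.+ k) *_) (cong (_* (ℤ.+ 1 / (2 ℕ.+ k))) (alternate s))) refl ⟩
  fromℕℚ (2 ℕ.+ k) * (- s * (ℤ.+ 1 / (2 ℕ.+ k))) + fromℕℚ (suc k) * (s * (ℤ.+ 1 / suc k))
    ≡⟨ regroup (fromℕℚ (2 ℕ.+ k)) (fromℕℚ (suc k)) s (ℤ.+ 1 / (2 ℕ.+ k)) (ℤ.+ 1 / suc k) ⟩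
  s * (fromℕℚ (suc k) * (ℤ.+ 1 / suc k)) - s * (fromℕℚ (2 ℕ.+ k) * (ℤ.+ 1 / (2 ℕ.+ k)))
    ≡⟨ cong₂ (λ a b → s * a - s * b) (n*1/n≡1 k) (n*1/n≡1 (suc k)) ⟩
  s * 1ℚ - s * 1ℚ
    ≡⟨ ℚₚ.+-inverseʳ (s * 1ℚ) ⟩
  0ℚ ∎
  where
  s = (- 1ℚ) ^ℚ k
  s′ = (- 1ℚ) ^ℚ suc k
  alternate : ∀ x → (- 1ℚ) * x ≡ - x
  alternate = solve-∀ ℚ-ring
  regroup : ∀ a b x p q → a * (- x * p) + b * (x * q) ≡ x * (b * q) - x * (a * p)
  regroup = solve-∀ ℚ-ring
  n*1/n≡1 : ∀ n → fromℕℚ (suc n) * (ℤ.+ 1 / suc n) ≡ 1ℚ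
  n*1/n≡1 n = trans (cong₂ _*_ (fromℕℚ-mkℚ (suc n)) (ℚₚ.normalize-coprime (Coprime.1-coprimeTo (suc n))))
                    (ℚₚ.*-inverseʳ (mkℚ (ℤ.+ suc n) 0 (Coprime.sym (Coprime.1-coprimeTo (suc n)))))

θ-onePlusZ^ : ∀ h → θ (onePlusZ ^ₛ h) ≈ₛ (fromℕℚ h ·ₛ (onePlusZ ^ₛ h))
θ-onePlusZ^ zero    k = trans (θ-one k) (sym (ℚₚ.*-zeroˡ (oneₛ k)))
θ-onePlusZ^ (suc h) k = begin
  θ (onePlusZ *ₛ P) k                                      ≡⟨ θ-Leibniz onePlusZ P k ⟩
  (θ onePlusZ *ₛ P) k + (onePlusZ *ₛ θ P) k                ≡⟨ cong₂ _+_ (*ₛ-congˡ P θ-onePlusZ k) (*ₛ-congʳ onePlusZ (θ-onePlusZ^ h) k) ⟩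
  (onePlusZ *ₛ P) k + (onePlusZ *ₛ (fromℕℚ h ·ₛ P)) k      ≡⟨ cong ((onePlusZ *ₛ P) k +_) (*ₛ-·ₛʳ (fromℕℚ h) onePlusZ P k) ⟩
  (onePlusZ *ₛ P) k + fromℕℚ h * (onePlusZ *ₛ P) k         ≡⟨ factor (fromℕℚ h) ((onePlusZ *ₛ P) k) ⟩
  (1ℚ + fromℕℚ h) * (onePlusZ *ₛ P) k                      ≡⟨ cong (_* (onePlusZ *ₛ P) k) (fromℕℚ-suc h) ⟨
  fromℕℚ (suc h) * (onePlusZ *ₛ P) k                       ∎
  where
  P = onePlusZ ^ₛ h
  factor : ∀ a x → x + a * x ≡ (1ℚ + a) * x
  factor = solve-∀ ℚ-ring

θ-log1p^ : ∀ j → θ (log1p ^ₛ suc j) ≈ₛ (fromℕℚ (suc j) ·ₛ (log1p ^ₛ j))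
θ-log1p^ zero k = begin
  θ (log1p *ₛ oneₛ) k                            ≡⟨ θ-Leibniz log1p oneₛ k ⟩
  (θ log1p *ₛ oneₛ) k + (log1p *ₛ θ oneₛ) k      ≡⟨ cong₂ _+_ (*ₛ-congˡ oneₛ θ-log1p k) (*ₛ-congʳ log1p θ-one k) ⟩
  (oneₛ *ₛ oneₛ) k + (log1p *ₛ 0ₛ) k             ≡⟨ cong₂ _+_ (*ₛ-identityˡ oneₛ k) (*ₛ-zeroʳ log1p k) ⟩
  oneₛ k + 0ℚ                                    ≡⟨ ℚₚ.+-identityʳ (oneₛ k) ⟩
  oneₛ k                                         ≡⟨ ℚₚ.*-identityˡ (oneₛ k) ⟨
  1ℚ * oneₛ k                                    ∎
θ-log1p^ (suc j) k = begin
  θ (log1p *ₛ L) k                                         ≡⟨ θ-Leibniz log1p L k ⟩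
  (θ log1p *ₛ L) k + (log1p *ₛ θ L) k                      ≡⟨ cong₂ _+_ (*ₛ-congˡ L θ-log1p k) (*ₛ-congʳ log1p (θ-log1p^ j) k) ⟩
  (oneₛ *ₛ L) k + (log1p *ₛ (fromℕℚ (suc j) ·ₛ (log1p ^ₛ j))) k
    ≡⟨ cong₂ _+_ (*ₛ-identityˡ L k) (*ₛ-·ₛʳ (fromℕℚ (suc j)) log1p (log1p ^ₛ j) k) ⟩
  L k + fromℕℚ (suc j) * L k                               ≡⟨ factor (fromℕℚ (suc j)) (L k) ⟩
  (1ℚ + fromℕℚ (suc j)) * L k                              ≡⟨ cong (_* L k) (fromℕℚ-suc (suc j)) ⟨
  fromℕℚ (suc (suc j)) * L k                               ∎
  where
  L = log1p ^ₛ suc j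
  factor : ∀ a x → x + a * x ≡ (1ℚ + a) * x
  factor = solve-∀ ℚ-ring

-- θ f k = (k + 1) f (k + 1) + k f k, so the coefficients of f vanish one after another.
θ-order : ∀ N f → f 0 ≡ 0ℚ → (∀ k → k < N → θ f k ≡ 0ℚ) → ∀ k → k ≤ N → f k ≡ 0ℚ
θ-order N f f0≡0 θf≡0 zero    _   = f0≡0
θ-order N f f0≡0 θf≡0 (suc k) k<N = p*q≡0⇒q≡0 (fromℕℚ (suc k)) (f (suc k)) (fromℕℚ-suc≢0 k) (begin
  fromℕℚ (suc k) * f (suc k)                ≡⟨ ℚₚ.+-identityʳ _ ⟨
  fromℕℚ (suc k) * f (suc k) + 0ℚ           ≡⟨ cong (fromℕℚ (suc k) * f (suc k) +_) fk≡0 ⟨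
  θ f k                                     ≡⟨ θf≡0 k k<N ⟩
  0ℚ                                        ∎)
  where
  fk≡0 : fromℕℚ k * f k ≡ 0ℚ
  fk≡0 = trans (cong (fromℕℚ k *_) (θ-order N f f0≡0 θf≡0 k (ℕₚ.<⇒≤ k<N))) (ℚₚ.*-zeroʳ (fromℕℚ k))

-- Series of the form Σ_{h,j} b h j (1 + z)^h log^j(1 + z) / j!

Coeffs : Set
Coeffs = ℕ → ℕ → ℚ

-- θ((1 + z)^h log^j/j!) = h (1 + z)^h log^j/j! + (1 + z)^h log^(j-1)/(j-1)!, read off on coefficients.
Θ : Coeffs → Coeffs
Θ b h j = fromℕℚ h * b h j + b h (suc j)

Θ^ : ℕ → Coeffs → Coeffs
Θ^ zero    b = b
Θ^ (suc k) b = Θ^ k (Θ b)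

onePlusZ^-0 : ∀ h → (onePlusZ ^ₛ h) 0 ≡ 1ℚ
onePlusZ^-0 zero    = refl
onePlusZ^-0 (suc h) = trans (ℚₚ.+-identityˡ _) (trans (ℚₚ.*-identityˡ _) (onePlusZ^-0 h))

onePlusZ^-beyond : ∀ h k → h < k → (onePlusZ ^ₛ h) k ≡ 0ℚ
onePlusZ^-beyond zero    (suc k) _   = refl
onePlusZ^-beyond (suc h) k       h<k = sum-zero (suc k) term
  where
  term : ∀ i → i < suc k → onePlusZ i * (onePlusZ ^ₛ h) (k ∸ i) ≡ 0ℚ
  term zero          _ = trans (cong (1ℚ *_) (onePlusZ^-beyond h k (ℕₚ.<-trans (ℕₚ.n<1+n h) h<k))) (ℚₚ.*-zeroʳ 1ℚ)
  term (suc zero)    _ = trans (cong (1ℚ *_) (onePlusZ^-beyond h (k ∸ 1) (ℕₚ.∸-monoˡ-≤ 1 h<k))) (ℚₚ.*-zeroʳ 1ℚ)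
  term (suc (suc i)) _ = ℚₚ.*-zeroˡ ((onePlusZ ^ₛ h) (k ∸ suc (suc i)))

log1p^suc-0 : ∀ j → (log1p ^ₛ suc j) 0 ≡ 0ℚ
log1p^suc-0 j = trans (ℚₚ.+-identityˡ _) (ℚₚ.*-zeroˡ ((log1p ^ₛ j) 0))

1/n!≡n+1/[n+1]! : ∀ j → fromℕℚ (suc j) * inv (fromℕℚ (suc j !)) ≡ inv (fromℕℚ (j !))
1/n!≡n+1/[n+1]! j = begin
  fromℕℚ (suc j) * inv (fromℕℚ (suc j ℕ.* j !))              ≡⟨ cong (λ z → fromℕℚ (suc j) * inv z) (fromℕℚ-* (suc j) (j !)) ⟩
  fromℕℚ (suc j) * inv (fromℕℚ (suc j) * fromℕℚ (j !))       ≡⟨ cong (fromℕℚ (suc j) *_) (inv-distrib-* (fromℕℚ (suc j)) (fromℕℚ (j !))) ⟩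
  fromℕℚ (suc j) * (inv (fromℕℚ (suc j)) * inv (fromℕℚ (j !))) ≡⟨ ℚₚ.*-assoc (fromℕℚ (suc j)) _ _ ⟨
  (fromℕℚ (suc j) * inv (fromℕℚ (suc j))) * inv (fromℕℚ (j !)) ≡⟨ cong (_* inv (fromℕℚ (j !))) (inv-inverseʳ (fromℕℚ (suc j)) (fromℕℚ-suc≢0 j)) ⟩
  1ℚ * inv (fromℕℚ (j !))                                    ≡⟨ ℚₚ.*-identityˡ _ ⟩
  inv (fromℕℚ (j !))                                         ∎

module LogSeries (m′ N : ℕ) where

  m : ℕ
  m = suc m′

  Truncated : Coeffs → Set
  Truncated b = ∀ h j → m ≤ j → b h j ≡ 0ℚ

  Θ-truncated : ∀ b → Truncated b → Truncated (Θ b)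
  Θ-truncated b tb h j m≤j = begin
    fromℕℚ h * b h j + b h (suc j) ≡⟨ cong₂ (λ x y → fromℕℚ h * x + y) (tb h j m≤j) (tb h (suc j) (ℕₚ.m≤n⇒m≤1+n m≤j)) ⟩
    fromℕℚ h * 0ℚ + 0ℚ             ≡⟨ cong (_+ 0ℚ) (ℚₚ.*-zeroʳ (fromℕℚ h)) ⟩
    0ℚ                             ∎

  coeffPoly : Coeffs → ℕ → Series
  coeffPoly b j k = inv (fromℕℚ (j !)) * sumUpTo N (λ h → b h j * (onePlusZ ^ₛ h) k)

  series : Coeffs → Series
  series b k = sumUpTo m (λ j → (coeffPoly b j *ₛ (log1p ^ₛ j)) k)

  σ : Coeffs → ℚ
  σ b = sumUpTo N (λ h → b h 0)

  θ-coeffPoly : ∀ b j → θ (coeffPoly b j) ≈ₛ coeffPoly (λ h j → fromℕℚ h * b h j) j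
  θ-coeffPoly b j k = begin
    fromℕℚ (suc k) * (c * sumUpTo N (λ h → b h j * P h (suc k))) + fromℕℚ k * (c * sumUpTo N (λ h → b h j * P h k))
      ≡⟨ factor-c (fromℕℚ (suc k)) (fromℕℚ k) c (sumUpTo N (λ h → b h j * P h (suc k))) (sumUpTo N (λ h → b h j * P h k)) ⟩
    c * (fromℕℚ (suc k) * sumUpTo N (λ h → b h j * P h (suc k)) + fromℕℚ k * sumUpTo N (λ h → b h j * P h k))
      ≡⟨ cong (c *_) (cong₂ _+_ (sum-distribˡ-* N (fromℕℚ (suc k)) _) (sum-distribˡ-* N (fromℕℚ k) _)) ⟩
    c * (sumUpTo N (λ h → fromℕℚ (suc k) * (b h j * P h (suc k))) + sumUpTo N (λ h → fromℕℚ k * (b h j * P h k)))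
      ≡⟨ cong (c *_) (sum-distrib-+ N _ _) ⟨
    c * sumUpTo N (λ h → fromℕℚ (suc k) * (b h j * P h (suc k)) + fromℕℚ k * (b h j * P h k))
      ≡⟨ cong (c *_) (sum-cong N term) ⟩
    c * sumUpTo N (λ h → (fromℕℚ h * b h j) * P h k) ∎
    where
    c = inv (fromℕℚ (j !))
    P = λ h → onePlusZ ^ₛ h
    factor-c : ∀ a a′ c x y → a * (c * x) + a′ * (c * y) ≡ c * (a * x + a′ * y)
    factor-c = solve-∀ ℚ-ring
    reassoc : ∀ B H p → B * (H * p) ≡ (H * B) * p
    reassoc = solve-∀ ℚ-ring
    term : ∀ h → fromℕℚ (suc k) * (b h j * P h (suc k)) + fromℕℚ k * (b h j * P h k) ≡ (fromℕℚ h * b h j) * P h k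
    term h = begin
      fromℕℚ (suc k) * (b h j * P h (suc k)) + fromℕℚ k * (b h j * P h k) ≡⟨ factor-c (fromℕℚ (suc k)) (fromℕℚ k) (b h j) _ _ ⟩
      b h j * θ (P h) k                                                   ≡⟨ cong (b h j *_) (θ-onePlusZ^ h k) ⟩
      b h j * (fromℕℚ h * P h k)                                          ≡⟨ reassoc (b h j) (fromℕℚ h) (P h k) ⟩
      (fromℕℚ h * b h j) * P h k                                          ∎

  coeffPoly-suc : ∀ b j → (fromℕℚ (suc j) ·ₛ coeffPoly b (suc j)) ≈ₛ coeffPoly (λ h j → b h (suc j)) j
  coeffPoly-suc b j k =
    trans (sym (ℚₚ.*-assoc (fromℕℚ (suc j)) _ _)) (cong (_* sumUpTo N (λ h → b h (suc j) * (onePlusZ ^ₛ h) k)) (1/n!≡n+1/[n+1]! j))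

  coeffPoly-+ : ∀ b b′ j → (coeffPoly b j +ₛ coeffPoly b′ j) ≈ₛ coeffPoly (λ h j → b h j + b′ h j) j
  coeffPoly-+ b b′ j k = begin
    c * sumUpTo N (λ h → b h j * P h) + c * sumUpTo N (λ h → b′ h j * P h) ≡⟨ ℚₚ.*-distribˡ-+ c _ _ ⟨
    c * (sumUpTo N (λ h → b h j * P h) + sumUpTo N (λ h → b′ h j * P h))   ≡⟨ cong (c *_) (sum-distrib-+ N _ _) ⟨
    c * sumUpTo N (λ h → b h j * P h + b′ h j * P h)                       ≡⟨ cong (c *_) (sum-cong N (λ h → ℚₚ.*-distribʳ-+ (P h) (b h j) (b′ h j))) ⟨
    c * sumUpTo N (λ h → (b h j + b′ h j) * P h)                           ∎
    where
    c = inv (fromℕℚ (j !))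
    P = λ h → (onePlusZ ^ₛ h) k

  coeffPoly-zero : ∀ b j → (∀ h → b h j ≡ 0ℚ) → coeffPoly b j ≈ₛ 0ₛ
  coeffPoly-zero b j b≡0 k =
    trans (cong (inv (fromℕℚ (j !)) *_) (sum-zero N (λ h _ → trans (cong (_* (onePlusZ ^ₛ h) k) (b≡0 h)) (ℚₚ.*-zeroˡ ((onePlusZ ^ₛ h) k)))))
          (ℚₚ.*-zeroʳ (inv (fromℕℚ (j !))))

  private
    log-term : ∀ b j → Series
    log-term b j = coeffPoly b j *ₛ (log1p ^ₛ j)

    θ-log-part : ∀ b → Truncated b → ∀ k →
      sumUpTo m (λ j → (coeffPoly b j *ₛ θ (log1p ^ₛ j)) k) ≡ sumUpTo m (λ j → log-term (λ h j → b h (suc j)) j k)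
    θ-log-part b tb k = begin
      sumUpTo (suc m′) (λ j → (coeffPoly b j *ₛ θ (log1p ^ₛ j)) k)
        ≡⟨ sum-suc-head m′ _ ⟩
      (coeffPoly b 0 *ₛ θ oneₛ) k + sumUpTo m′ (λ j → (coeffPoly b (suc j) *ₛ θ (log1p ^ₛ suc j)) k)
        ≡⟨ cong₂ _+_ (trans (*ₛ-congʳ (coeffPoly b 0) θ-one k) (*ₛ-zeroʳ (coeffPoly b 0) k)) (sum-cong m′ lower) ⟩
      0ℚ + sumUpTo m′ (λ j → log-term b′ j k)
        ≡⟨ ℚₚ.+-identityˡ _ ⟩
      sumUpTo m′ (λ j → log-term b′ j k)
        ≡⟨ ℚₚ.+-identityʳ _ ⟨
      sumUpTo m′ (λ j → log-term b′ j k) + 0ℚ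
        ≡⟨ cong (sumUpTo m′ (λ j → log-term b′ j k) +_) top ⟨
      sumUpTo (suc m′) (λ j → log-term b′ j k) ∎
      where
      b′ = λ h j → b h (suc j)
      lower : ∀ j → (coeffPoly b (suc j) *ₛ θ (log1p ^ₛ suc j)) k ≡ log-term b′ j k
      lower j = begin
        (coeffPoly b (suc j) *ₛ θ (log1p ^ₛ suc j)) k                        ≡⟨ *ₛ-congʳ (coeffPoly b (suc j)) (θ-log1p^ j) k ⟩
        (coeffPoly b (suc j) *ₛ (fromℕℚ (suc j) ·ₛ (log1p ^ₛ j))) k          ≡⟨ *ₛ-·ₛʳ (fromℕℚ (suc j)) (coeffPoly b (suc j)) (log1p ^ₛ j) k ⟩
        fromℕℚ (suc j) * (coeffPoly b (suc j) *ₛ (log1p ^ₛ j)) k             ≡⟨ *ₛ-·ₛˡ (fromℕℚ (suc j)) (coeffPoly b (suc j)) (log1p ^ₛ j) k ⟨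
        ((fromℕℚ (suc j) ·ₛ coeffPoly b (suc j)) *ₛ (log1p ^ₛ j)) k          ≡⟨ *ₛ-congˡ (log1p ^ₛ j) (coeffPoly-suc b j) k ⟩
        log-term b′ j k                                                      ∎
      top : log-term b′ m′ k ≡ 0ℚ
      top = trans (*ₛ-congˡ (log1p ^ₛ m′) (coeffPoly-zero b′ m′ (λ h → tb h m ℕₚ.≤-refl)) k) (*ₛ-zeroˡ (log1p ^ₛ m′) k)

  θ-series : ∀ b → Truncated b → θ (series b) ≈ₛ series (Θ b)
  θ-series b tb k = begin
    θ (series b) k
      ≡⟨ θ-sum m (log-term b) k ⟩
    sumUpTo m (λ j → θ (log-term b j) k)
      ≡⟨ sum-cong m (λ j → θ-Leibniz (coeffPoly b j) (log1p ^ₛ j) k) ⟩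
    sumUpTo m (λ j → (θ (coeffPoly b j) *ₛ (log1p ^ₛ j)) k + (coeffPoly b j *ₛ θ (log1p ^ₛ j)) k)
      ≡⟨ sum-distrib-+ m _ _ ⟩
    sumUpTo m (λ j → (θ (coeffPoly b j) *ₛ (log1p ^ₛ j)) k) + sumUpTo m (λ j → (coeffPoly b j *ₛ θ (log1p ^ₛ j)) k)
      ≡⟨ cong₂ _+_ (sum-cong m (λ j → *ₛ-congˡ (log1p ^ₛ j) (θ-coeffPoly b j) k)) (θ-log-part b tb k) ⟩
    sumUpTo m (λ j → log-term hb j k) + sumUpTo m (λ j → log-term b′ j k)
      ≡⟨ sum-distrib-+ m _ _ ⟨
    sumUpTo m (λ j → log-term hb j k + log-term b′ j k)
      ≡⟨ sum-cong m (λ j → trans (sym (*ₛ-distribʳ-+ₛ (coeffPoly hb j) (coeffPoly b′ j) (log1p ^ₛ j) k))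
                                 (*ₛ-congˡ (log1p ^ₛ j) (coeffPoly-+ hb b′ j) k)) ⟩
    series (Θ b) k ∎
    where
    hb = λ h j → fromℕℚ h * b h j
    b′ = λ h j → b h (suc j)

  series-0 : ∀ b → series b 0 ≡ σ b
  series-0 b = begin
    sumUpTo (suc m′) (λ j → log-term b j 0)
      ≡⟨ sum-suc-head m′ _ ⟩
    (0ℚ + coeffPoly b 0 0 * 1ℚ) + sumUpTo m′ (λ j → log-term b (suc j) 0)
      ≡⟨ cong₂ _+_ (trans (ℚₚ.+-identityˡ _) (ℚₚ.*-identityʳ (coeffPoly b 0 0))) (sum-zero m′ (λ j _ → higher j)) ⟩
    1ℚ * sumUpTo N (λ h → b h 0 * (onePlusZ ^ₛ h) 0) + 0ℚ
      ≡⟨ trans (ℚₚ.+-identityʳ _) (ℚₚ.*-identityˡ (sumUpTo N (λ h → b h 0 * (onePlusZ ^ₛ h) 0))) ⟩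
    sumUpTo N (λ h → b h 0 * (onePlusZ ^ₛ h) 0)
      ≡⟨ sum-cong N (λ h → trans (cong (b h 0 *_) (onePlusZ^-0 h)) (ℚₚ.*-identityʳ (b h 0))) ⟩
    σ b ∎
    where
    higher : ∀ j → log-term b (suc j) 0 ≡ 0ℚ
    higher j = trans (ℚₚ.+-identityˡ _) (trans (cong (coeffPoly b (suc j) 0 *_) (log1p^suc-0 j)) (ℚₚ.*-zeroʳ (coeffPoly b (suc j) 0)))

  series-order : ∀ K b → Truncated b → (∀ k → k < K → σ (Θ^ k b) ≡ 0ℚ) → ∀ k → k < K → series b k ≡ 0ℚ
  series-order (suc K) b tb σ≡0 k k<1+K = θ-order K (series b) (trans (series-0 b) (σ≡0 0 ℕ.z<s))
    (λ i i<K → trans (θ-series b tb i)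
                     (series-order K (Θ b) (Θ-truncated b tb) (λ i′ i′<K → σ≡0 (suc i′) (s≤s i′<K)) i i<K))
    k (ℕₚ.≤-pred k<1+K)

  series-zero : ∀ k b → Truncated b → series b ≈ₛ 0ₛ → σ (Θ^ k b) ≡ 0ℚ
  series-zero zero    b tb b≈0 = trans (sym (series-0 b)) (b≈0 0)
  series-zero (suc k) b tb b≈0 = series-zero k (Θ b) (Θ-truncated b tb)
    (λ i → trans (sym (θ-series b tb i)) (trans (θ-cong b≈0 i) (θ-zero i)))

-- Generating polynomials in y = 1/x

u : ℕ → ℚ → ℚ
u h y = 1ℚ - fromℕℚ h * y

poly-u : ∀ h → IsPoly (u h)
poly-u h = poly-sub (poly-const 1ℚ) (poly-scale (fromℕℚ h) poly-id)

u-0 : ∀ h → u h 0ℚ ≡ 1ℚ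
u-0 h = cong (λ z → 1ℚ - z) (ℚₚ.*-zeroʳ (fromℕℚ h))

u-root : ∀ h n → u h (inv (fromℕℚ (suc n))) ≡ 0ℚ → h ≡ suc n
u-root h n uh≡0 = fromℕℚ-injective h (suc n) (begin
  fromℕℚ h                   ≡⟨ ℚₚ.*-identityʳ (fromℕℚ h) ⟨
  fromℕℚ h * 1ℚ              ≡⟨ cong (fromℕℚ h *_) (inv-inverseˡ X (fromℕℚ-suc≢0 n)) ⟨
  fromℕℚ h * (inv X * X)     ≡⟨ ℚₚ.*-assoc (fromℕℚ h) (inv X) X ⟨
  (fromℕℚ h * inv X) * X     ≡⟨ cong (_* X) (p-q≡0⇒p≡q 1ℚ (fromℕℚ h * inv X) uh≡0) ⟨
  1ℚ * X                     ≡⟨ ℚₚ.*-identityˡ X ⟩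
  X                          ∎)
  where
  X = fromℕℚ (suc n)

u-at-root : ∀ n → u (suc n) (inv (fromℕℚ (suc n))) ≡ 0ℚ
u-at-root n = trans (cong (λ z → 1ℚ - z) (inv-inverseʳ (fromℕℚ (suc n)) (fromℕℚ-suc≢0 n))) (ℚₚ.+-inverseʳ 1ℚ)

-- Sample points 1/(c + 1), 1/(c + 2), … avoiding 0 and the roots 1/h (1 ≤ h ≤ c) of the u h.
farPoint : ℕ → ℕ → ℚ
farPoint c i = inv (fromℕℚ (suc (c ℕ.+ i)))

farPoint-injective : ∀ c → Injective _≡_ _≡_ (farPoint c)
farPoint-injective c {i} {j} eq = ℕₚ.+-cancelˡ-≡ c i j (ℕₚ.suc-injective (fromℕℚ-injective _ _
  (trans (sym (inv-involutive _)) (trans (cong inv eq) (inv-involutive _)))))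

farPoint-≢0 : ∀ c i → farPoint c i ≢ 0ℚ
farPoint-≢0 c i = inv-≢0 _ (fromℕℚ-suc≢0 (c ℕ.+ i))

u-farPoint-≢0 : ∀ c i h → h ≤ c → u h (farPoint c i) ≢ 0ℚ
u-farPoint-≢0 c i h h≤c uh≡0 = ℕₚ.<-irrefl (u-root h (c ℕ.+ i) uh≡0) (s≤s (ℕₚ.≤-trans h≤c (ℕₚ.m≤m+n c i)))

poly-cancel : ∀ c (p : ℚ → ℚ) {f g} → IsPoly f → IsPoly g → (∀ i → p (farPoint c i) ≢ 0ℚ) →
              (∀ y → p y * f y ≡ p y * g y) → ∀ y → f y ≡ g y
poly-cancel c p pf pg p≢0 eq = poly-ext pf pg (farPoint c) (farPoint-injective c)
  (λ i → *-cancelˡ-≢0 (p (farPoint c i)) _ _ (p≢0 i) (eq (farPoint c i)))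

-- With u = u h y and x = 1/y, S h n β y = uⁿ Σ_{j<n} β j (y/u)^(j+1) = uⁿ Σ_{j<n} β j / (x - h)^(j+1).
S : ℕ → ℕ → (ℕ → ℚ) → ℚ → ℚ
S h zero    β y = 0ℚ
S h (suc n) β y = β 0 * y * u h y ^ℚ n + y * S h n (λ j → β (suc j)) y

poly-S : ∀ h n β → IsPoly (S h n β)
poly-S h zero    β = poly-const 0ℚ
poly-S h (suc n) β = poly-+ (poly-* (poly-scale (β 0) poly-id) (poly-^ n (poly-u h))) (poly-* poly-id (poly-S h n (λ j → β (suc j))))

S-closed-form : ∀ h n β y → u h y ≢ 0ℚ → S h n β y ≡ sumUpTo n (λ j → β j * (y * inv (u h y)) ^ℚ suc j) * u h y ^ℚ n
S-closed-form h zero    β y _    = sym (ℚₚ.*-zeroˡ 1ℚ)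
S-closed-form h (suc n) β y uh≢0 = begin
  β 0 * y * U + y * S h n (λ j → β (suc j)) y
    ≡⟨ cong (λ z → β 0 * y * U + y * z) (S-closed-form h n (λ j → β (suc j)) y uh≢0) ⟩
  β 0 * y * U + y * (Σ′ * U)
    ≡⟨ cong₂ (λ a b → β 0 * a * U + b * (Σ′ * U)) w*u≡y w*u≡y ⟨
  β 0 * (w * uh) * U + (w * uh) * (Σ′ * U)
    ≡⟨ regroup (β 0) w uh U Σ′ ⟩
  (β 0 * (w * 1ℚ) + w * Σ′) * (uh * U)
    ≡⟨ cong (λ z → (β 0 * (w * 1ℚ) + z) * (uh * U)) (sum-distribˡ-* n w _) ⟩
  (β 0 * (w * 1ℚ) + sumUpTo n (λ j → w * (β (suc j) * w ^ℚ suc j))) * (uh * U)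
    ≡⟨ cong (λ z → (β 0 * (w * 1ℚ) + z) * (uh * U)) (sum-cong n (λ j → swap w (β (suc j)) (w ^ℚ suc j))) ⟩
  (β 0 * (w * 1ℚ) + sumUpTo n (λ j → β (suc j) * w ^ℚ suc (suc j))) * (uh * U)
    ≡⟨ cong (_* (uh * U)) (sum-suc-head n (λ j → β j * w ^ℚ suc j)) ⟨
  sumUpTo (suc n) (λ j → β j * w ^ℚ suc j) * (uh * U) ∎
  where
  uh = u h y
  U  = u h y ^ℚ n
  w  = y * inv uh
  Σ′ = sumUpTo n (λ j → β (suc j) * w ^ℚ suc j)
  w*u≡y : w * uh ≡ y
  w*u≡y = trans (ℚₚ.*-assoc y (inv uh) uh) (trans (cong (y *_) (inv-inverseˡ uh uh≢0)) (ℚₚ.*-identityʳ y))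
  regroup : ∀ b w u U S → b * (w * u) * U + (w * u) * (S * U) ≡ (b * (w * 1ℚ) + w * S) * (u * U)
  regroup = solve-∀ ℚ-ring
  swap : ∀ w b W → w * (b * W) ≡ b * (w * W)
  swap = solve-∀ ℚ-ring

S-step : ∀ h n β → β n ≡ 0ℚ → ∀ y →
  S h n β y ≡ y * (β 0 * u h y ^ℚ n + S h n (λ j → fromℕℚ h * β j + β (suc j)) y)
S-step h zero    β βn≡0 y = sym (trans (cong (λ z → y * (z * 1ℚ + 0ℚ)) βn≡0) (vanish y))
  where
  vanish : ∀ y → y * (0ℚ * 1ℚ + 0ℚ) ≡ 0ℚ
  vanish = solve-∀ ℚ-ring
S-step h (suc n) β βn≡0 y = begin
  β 0 * y * U + y * S h n (λ j → β (suc j)) y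
    ≡⟨ cong (λ z → β 0 * y * U + y * z) (S-step h n (λ j → β (suc j)) βn≡0 y) ⟩
  β 0 * y * U + y * (y * (β 1 * U + W))
    ≡⟨ regroup (β 0) (β 1) y (fromℕℚ h) U W ⟩
  y * (β 0 * ((1ℚ - fromℕℚ h * y) * U) + ((fromℕℚ h * β 0 + β 1) * y * U + y * W)) ∎
  where
  U = u h y ^ℚ n
  W = S h n (λ j → fromℕℚ h * β (suc j) + β (suc (suc j))) y
  regroup : ∀ b₀ b₁ y h U W → b₀ * y * U + y * (y * (b₁ * U + W)) ≡ y * (b₀ * ((1ℚ - h * y) * U) + ((h * b₀ + b₁) * y * U + y * W))
  regroup = solve-∀ ℚ-ring

S-at-root : ∀ h n β y → u h y ≡ 0ℚ → S h (suc n) β y ≡ β n * y ^ℚ suc n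
S-at-root h zero    β y _    = drop (β 0) y
  where
  drop : ∀ b y → b * y * 1ℚ + y * 0ℚ ≡ b * (y * 1ℚ)
  drop = solve-∀ ℚ-ring
S-at-root h (suc n) β y uh≡0 = begin
  β 0 * y * (u h y * u h y ^ℚ n) + y * S h (suc n) (λ j → β (suc j)) y
    ≡⟨ cong₂ (λ a b → β 0 * y * (a * u h y ^ℚ n) + y * b) uh≡0 (S-at-root h n (λ j → β (suc j)) y uh≡0) ⟩
  β 0 * y * (0ℚ * u h y ^ℚ n) + y * (β (suc n) * y ^ℚ suc n)
    ≡⟨ drop (β 0) y (u h y ^ℚ n) (β (suc n)) (y ^ℚ suc n) ⟩
  β (suc n) * (y * y ^ℚ suc n) ∎
  where
  drop : ∀ b y U c Y → b * y * (0ℚ * U) + y * (c * Y) ≡ c * (y * Y)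
  drop = solve-∀ ℚ-ring

S-zero : ∀ h n β → (∀ j → β j ≡ 0ℚ) → ∀ y → S h n β y ≡ 0ℚ
S-zero h zero    β β≡0 y = refl
S-zero h (suc n) β β≡0 y =
  trans (cong₂ (λ a b → a * y * u h y ^ℚ n + y * b) (β≡0 0) (S-zero h n (λ j → β (suc j)) (λ j → β≡0 (suc j)) y))
        (vanish y (u h y ^ℚ n))
  where
  vanish : ∀ y U → 0ℚ * y * U + y * 0ℚ ≡ 0ℚ
  vanish = solve-∀ ℚ-ring

S-+ : ∀ h n t β → (∀ j → n ≤ j → β j ≡ 0ℚ) → ∀ y → S h (n ℕ.+ t) β y ≡ u h y ^ℚ t * S h n β y
S-+ h zero    t β β≡0 y = trans (S-zero h t β (λ j → β≡0 j z≤n) y) (sym (ℚₚ.*-zeroʳ (u h y ^ℚ t)))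
S-+ h (suc n) t β β≡0 y = begin
  β 0 * y * u h y ^ℚ (n ℕ.+ t) + y * S h (n ℕ.+ t) (λ j → β (suc j)) y
    ≡⟨ cong₂ (λ a b → β 0 * y * a + y * b) (trans (cong (u h y ^ℚ_) (ℕₚ.+-comm n t)) (^-distribˡ-+-* (u h y) t n))
                                          (S-+ h n t (λ j → β (suc j)) (λ j n≤j → β≡0 (suc j) (s≤s n≤j)) y) ⟩
  β 0 * y * (u h y ^ℚ t * u h y ^ℚ n) + y * (u h y ^ℚ t * S h n (λ j → β (suc j)) y)
    ≡⟨ factor (β 0) y (u h y ^ℚ t) (u h y ^ℚ n) (S h n (λ j → β (suc j)) y) ⟩
  u h y ^ℚ t * (β 0 * y * u h y ^ℚ n + y * S h n (λ j → β (suc j)) y) ∎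
  where
  factor : ∀ b y T U W → b * y * (T * U) + y * (T * W) ≡ T * (b * y * U + y * W)
  factor = solve-∀ ℚ-ring

module GeneratingPolynomial (m′ N : ℕ) where

  open LogSeries m′ N

  M : ℚ → ℚ
  M y = prodUpTo N (λ h → u h y ^ℚ m)

  M-without : ℕ → ℚ → ℚ
  M-without h y = prodUpTo N (update (λ h′ → u h′ y ^ℚ m) h 1ℚ)

  -- For x = 1/y, Ψ b = M Σ_{h, j<m} b h j / (x - h)^(j+1), with all denominators cleared.
  Ψ : Coeffs → ℚ → ℚ
  Ψ b y = sumUpTo N (λ h → S h m (b h) y * M-without h y)

  poly-M : IsPoly M
  poly-M = poly-prod N (λ h y → u h y ^ℚ m) (λ h _ → poly-^ m (poly-u h))

  poly-update-u^ : ∀ h h′ → IsPoly (λ y → update (λ h″ → u h″ y ^ℚ m) h 1ℚ h′)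
  poly-update-u^ h h′ with h′ ≡ᵇ h
  ... | true  = poly-const 1ℚ
  ... | false = poly-^ m (poly-u h′)

  poly-M-without : ∀ h → IsPoly (M-without h)
  poly-M-without h = poly-prod N (λ h′ y → update (λ h″ → u h″ y ^ℚ m) h 1ℚ h′) (λ h′ _ → poly-update-u^ h h′)

  poly-Ψ : ∀ b → IsPoly (Ψ b)
  poly-Ψ b = poly-sum N (λ h y → S h m (b h) y * M-without h y) (λ h _ → poly-* (poly-S h m (b h)) (poly-M-without h))

  M-0 : M 0ℚ ≡ 1ℚ
  M-0 = prod-one N (λ h _ → trans (cong (_^ℚ m) (u-0 h)) (1^n≡1 m))

  Ψ-step : ∀ b → Truncated b → ∀ y → Ψ b y ≡ y * (σ b * M y + Ψ (Θ b) y)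
  Ψ-step b tb y = begin
    sumUpTo N (λ h → S h m (b h) y * M-without h y)
      ≡⟨ sum-cong N (λ h → cong (_* M-without h y) (S-step h m (b h) (tb h m ℕₚ.≤-refl) y)) ⟩
    sumUpTo N (λ h → y * (b h 0 * u h y ^ℚ m + S h m (Θ b h) y) * M-without h y)
      ≡⟨ sum-cong< N (λ h h<N → trans (expand y (b h 0) (u h y ^ℚ m) (S h m (Θ b h) y) (M-without h y))
                                      (cong (λ z → y * (b h 0 * z) + y * (S h m (Θ b h) y * M-without h y))
                                            (prod-remove N (λ h′ → u h′ y ^ℚ m) h h<N))) ⟩
    sumUpTo N (λ h → y * (b h 0 * M y) + y * (S h m (Θ b h) y * M-without h y))
      ≡⟨ sum-distrib-+ N _ _ ⟩
    sumUpTo N (λ h → y * (b h 0 * M y)) + sumUpTo N (λ h → y * (S h m (Θ b h) y * M-without h y))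
      ≡⟨ cong₂ _+_ (sum-distribˡ-* N y _) (sum-distribˡ-* N y _) ⟨
    y * sumUpTo N (λ h → b h 0 * M y) + y * Ψ (Θ b) y
      ≡⟨ cong (λ z → y * z + y * Ψ (Θ b) y) (sum-distribʳ-* N (M y) (λ h → b h 0)) ⟨
    y * (σ b * M y) + y * Ψ (Θ b) y
      ≡⟨ ℚₚ.*-distribˡ-+ y _ _ ⟨
    y * (σ b * M y + Ψ (Θ b) y) ∎
    where
    expand : ∀ y b U S P → y * (b * U + S) * P ≡ y * (b * (U * P)) + y * (S * P)
    expand = solve-∀ ℚ-ring

  -- One step of the expansion Ψ b / M = Σ_k σ (Θ^k b) y^(k+1).
  Ψ-peel : ∀ b W → Truncated b → IsPoly W → (∀ y → Ψ b y ≡ y * W y) →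
           σ b ≡ W 0ℚ × (∀ y → Ψ (Θ b) y ≡ W y - σ b * M y)
  Ψ-peel b W tb pW Ψ≡yW = σ≡W0 , ΨΘ≡
    where
    σM+ΨΘ≡W : ∀ y → σ b * M y + Ψ (Θ b) y ≡ W y
    σM+ΨΘ≡W = poly-cancel 0 (λ y → y) (poly-+ (poly-scale (σ b) poly-M) (poly-Ψ (Θ b))) pW (farPoint-≢0 0)
                (λ y → trans (sym (Ψ-step b tb y)) (Ψ≡yW y))
    ΨΘ-0 : Ψ (Θ b) 0ℚ ≡ 0ℚ
    ΨΘ-0 = trans (Ψ-step (Θ b) (Θ-truncated b tb) 0ℚ) (ℚₚ.*-zeroˡ (σ (Θ b) * M 0ℚ + Ψ (Θ (Θ b)) 0ℚ))
    σ≡W0 : σ b ≡ W 0ℚ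
    σ≡W0 = begin
      σ b                         ≡⟨ simplify (σ b) ⟨
      σ b * 1ℚ + 0ℚ               ≡⟨ cong₂ (λ a c → σ b * a + c) M-0 ΨΘ-0 ⟨
      σ b * M 0ℚ + Ψ (Θ b) 0ℚ     ≡⟨ σM+ΨΘ≡W 0ℚ ⟩
      W 0ℚ                        ∎
      where
      simplify : ∀ s → s * 1ℚ + 0ℚ ≡ s
      simplify = solve-∀ ℚ-ring
    ΨΘ≡ : ∀ y → Ψ (Θ b) y ≡ W y - σ b * M y
    ΨΘ≡ y = trans (rearrange (σ b * M y) (Ψ (Θ b) y)) (cong (_- σ b * M y) (σM+ΨΘ≡W y))
      where
      rearrange : ∀ a c → c ≡ (a + c) - a
      rearrange = solve-∀ ℚ-ring

  σ-Θ^ : ∀ k b W → Truncated b → IsPoly W → (∀ y → Ψ b y ≡ y ^ℚ suc k * W y) → σ (Θ^ k b) ≡ W 0ℚ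
  σ-Θ^ zero    b W tb pW Ψ≡ =
    proj₁ (Ψ-peel b W tb pW (λ y → trans (Ψ≡ y) (cong (_* W y) (ℚₚ.*-identityʳ y))))
  σ-Θ^ (suc k) b W tb pW Ψ≡ = σ-Θ^ k (Θ b) W (Θ-truncated b tb) pW ΨΘ≡
    where
    W′ : ℚ → ℚ
    W′ y = y ^ℚ suc k * W y
    peeled = Ψ-peel b W′ tb (poly-* (poly-^ (suc k) poly-id) pW) (λ y → trans (Ψ≡ y) (ℚₚ.*-assoc y _ (W y)))
    σ≡0 : σ b ≡ 0ℚ
    σ≡0 = trans (proj₁ peeled) (trans (cong (_* W 0ℚ) (0^suc≡0 k)) (ℚₚ.*-zeroˡ (W 0ℚ)))
    ΨΘ≡ : ∀ y → Ψ (Θ b) y ≡ y ^ℚ suc k * W y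
    ΨΘ≡ y = trans (proj₂ peeled y) (trans (cong (λ s → W′ y - s * M y) σ≡0) (drop (W′ y) (M y)))
      where
      drop : ∀ w p → w - 0ℚ * p ≡ w
      drop = solve-∀ ℚ-ring

-- The partial fraction identity as a polynomial identity

PartialFractionIdentity : ℕ → (ℕ → ℕ) → ℕ → (ℕ → ℕ → ℚ) → Set
PartialFractionIdentity n₀ e m a =
  ∀ x → (∀ h → h ≤ n₀ → x ≢ fromℕℚ h) →
  inv (prodUpTo (suc n₀) (λ h → (x - fromℕℚ h) ^ℚ e h))
    ≡ sumUpTo (suc n₀) (λ h → sumUpTo m (λ j → a h (suc j) * inv ((x - fromℕℚ h) ^ℚ suc j)))

module PartialFractions (m′ n₀ : ℕ) (e : ℕ → ℕ) (e≤m : ∀ h → e h ≤ suc m′)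
                        (a : ℕ → ℕ → ℚ) (pf : PartialFractionIdentity n₀ e (suc m′) a) where

  N : ℕ
  N = suc n₀

  open LogSeries m′ N
  open GeneratingPolynomial m′ N

  b₀ : Coeffs
  b₀ h j = if j <ᵇ m then a h (suc j) else 0ℚ

  b₀-below : ∀ h j → j < m → b₀ h j ≡ a h (suc j)
  b₀-below h j j<m = cong (if_then a h (suc j) else 0ℚ) (dec-true (j ℕₚ.<? m) j<m)

  b₀-truncated : Truncated b₀
  b₀-truncated h j m≤j = cong (if_then a h (suc j) else 0ℚ) (dec-false (j ℕₚ.<? m) (ℕₚ.≤⇒≯ m≤j))

  D : ℕ
  D = sumℕ N e

  V : ℚ → ℚ
  V y = prodUpTo N (λ h → u h y ^ℚ (m ∸ e h))

  poly-V : IsPoly V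
  poly-V = poly-prod N (λ h y → u h y ^ℚ (m ∸ e h)) (λ h _ → poly-^ (m ∸ e h) (poly-u h))

  V-0 : V 0ℚ ≡ 1ℚ
  V-0 = prod-one N (λ h _ → trans (cong (_^ℚ (m ∸ e h)) (u-0 h)) (1^n≡1 (m ∸ e h)))

  module AtPoint (y x : ℚ) (x*y≡1 : x * y ≡ 1ℚ) (u≢0 : ∀ h → h < N → u h y ≢ 0ℚ) where

    inv-x : inv x ≡ y
    inv-x = inv-unique x y (λ x≡0 → 1≢0 (trans (sym x*y≡1) (trans (cong (_* y) x≡0) (ℚₚ.*-zeroˡ y)))) x*y≡1

    x-h≡x*u : ∀ h → x - fromℕℚ h ≡ x * u h y
    x-h≡x*u h = begin
      x - fromℕℚ h                ≡⟨ cong (λ z → x - z) (ℚₚ.*-identityʳ (fromℕℚ h)) ⟨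
      x - fromℕℚ h * 1ℚ           ≡⟨ cong (λ z → x - fromℕℚ h * z) x*y≡1 ⟨
      x - fromℕℚ h * (x * y)      ≡⟨ factor x (fromℕℚ h) y ⟩
      x * (1ℚ - fromℕℚ h * y)     ∎
      where
      factor : ∀ x h y → x - h * (x * y) ≡ x * (1ℚ - h * y)
      factor = solve-∀ ℚ-ring

    inv-x-h^ : ∀ h k → inv ((x - fromℕℚ h) ^ℚ k) ≡ y ^ℚ k * inv (u h y ^ℚ k)
    inv-x-h^ h k = begin
      inv ((x - fromℕℚ h) ^ℚ k)          ≡⟨ cong (λ z → inv (z ^ℚ k)) (x-h≡x*u h) ⟩
      inv ((x * u h y) ^ℚ k)             ≡⟨ cong inv (^-distribʳ-* x (u h y) k) ⟩
      inv (x ^ℚ k * u h y ^ℚ k)          ≡⟨ inv-distrib-* (x ^ℚ k) (u h y ^ℚ k) ⟩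
      inv (x ^ℚ k) * inv (u h y ^ℚ k)    ≡⟨ cong (_* inv (u h y ^ℚ k)) (trans (inv-distrib-^ x k) (cong (_^ℚ k) inv-x)) ⟩
      y ^ℚ k * inv (u h y ^ℚ k)          ∎

    u^m/u^e : ∀ h → h < N → inv (u h y ^ℚ e h) * u h y ^ℚ m ≡ u h y ^ℚ (m ∸ e h)
    u^m/u^e h h<N = begin
      inv (U ^ℚ e h) * U ^ℚ m                           ≡⟨ cong (λ z → inv (U ^ℚ e h) * U ^ℚ z) (ℕₚ.m+[n∸m]≡n (e≤m h)) ⟨
      inv (U ^ℚ e h) * U ^ℚ (e h ℕ.+ (m ∸ e h))         ≡⟨ cong (inv (U ^ℚ e h) *_) (^-distribˡ-+-* U (e h) (m ∸ e h)) ⟩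
      inv (U ^ℚ e h) * (U ^ℚ e h * U ^ℚ (m ∸ e h))      ≡⟨ ℚₚ.*-assoc (inv (U ^ℚ e h)) (U ^ℚ e h) _ ⟨
      (inv (U ^ℚ e h) * U ^ℚ e h) * U ^ℚ (m ∸ e h)      ≡⟨ cong (_* U ^ℚ (m ∸ e h)) (inv-inverseˡ _ (^-≢0 U (e h) (u≢0 h h<N))) ⟩
      1ℚ * U ^ℚ (m ∸ e h)                               ≡⟨ ℚₚ.*-identityˡ _ ⟩
      U ^ℚ (m ∸ e h)                                    ∎
      where
      U = u h y

    denominator : inv (prodUpTo N (λ h → (x - fromℕℚ h) ^ℚ e h)) * M y ≡ y ^ℚ D * V y
    denominator = begin
      inv (prodUpTo N (λ h → (x - fromℕℚ h) ^ℚ e h)) * M y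
        ≡⟨ cong (_* M y) (inv-distrib-prod N _) ⟩
      prodUpTo N (λ h → inv ((x - fromℕℚ h) ^ℚ e h)) * M y
        ≡⟨ cong (_* M y) (prod-cong< N (λ h _ → inv-x-h^ h (e h))) ⟩
      prodUpTo N (λ h → y ^ℚ e h * inv (u h y ^ℚ e h)) * M y
        ≡⟨ cong (_* M y) (prod-distrib-* N _ _) ⟩
      (prodUpTo N (λ h → y ^ℚ e h) * prodUpTo N (λ h → inv (u h y ^ℚ e h))) * M y
        ≡⟨ ℚₚ.*-assoc (prodUpTo N (λ h → y ^ℚ e h)) _ (M y) ⟩
      prodUpTo N (λ h → y ^ℚ e h) * (prodUpTo N (λ h → inv (u h y ^ℚ e h)) * M y)
        ≡⟨ cong₂ _*_ (sym (prod-^ N y e)) (prod-distrib-* N (λ h → inv (u h y ^ℚ e h)) (λ h → u h y ^ℚ m)) ⟨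
      y ^ℚ D * prodUpTo N (λ h → inv (u h y ^ℚ e h) * u h y ^ℚ m)
        ≡⟨ cong (y ^ℚ D *_) (prod-cong< N u^m/u^e) ⟩
      y ^ℚ D * V y ∎

    partialFractions : sumUpTo N (λ h → sumUpTo m (λ j → a h (suc j) * inv ((x - fromℕℚ h) ^ℚ suc j))) * M y ≡ Ψ b₀ y
    partialFractions = trans (sum-distribʳ-* N (M y) _) (sum-cong< N term)
      where
      term : ∀ h → h < N → sumUpTo m (λ j → a h (suc j) * inv ((x - fromℕℚ h) ^ℚ suc j)) * M y ≡ S h m (b₀ h) y * M-without h y
      term h h<N = begin
        sumUpTo m (λ j → a h (suc j) * inv ((x - fromℕℚ h) ^ℚ suc j)) * M y
          ≡⟨ cong (_* M y) (sum-cong< m (λ j j<m → cong₂ _*_ (sym (b₀-below h j j<m)) (trans (inv-x-h^ h (suc j)) (pole j)))) ⟩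
        Σβ * M y
          ≡⟨ cong (Σβ *_) (prod-remove N (λ h′ → u h′ y ^ℚ m) h h<N) ⟨
        Σβ * (u h y ^ℚ m * M-without h y)
          ≡⟨ ℚₚ.*-assoc Σβ (u h y ^ℚ m) (M-without h y) ⟨
        (Σβ * u h y ^ℚ m) * M-without h y
          ≡⟨ cong (_* M-without h y) (S-closed-form h m (b₀ h) y (u≢0 h h<N)) ⟨
        S h m (b₀ h) y * M-without h y ∎
        where
        Σβ = sumUpTo m (λ j → b₀ h j * (y * inv (u h y)) ^ℚ suc j)
        pole : ∀ k → y ^ℚ suc k * inv (u h y ^ℚ suc k) ≡ (y * inv (u h y)) ^ℚ suc k
        pole k = trans (cong (y ^ℚ suc k *_) (inv-distrib-^ (u h y) (suc k))) (sym (^-distribʳ-* y (inv (u h y)) (suc k)))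

    x-not-pole : ∀ h → h ≤ n₀ → x ≢ fromℕℚ h
    x-not-pole h h≤n₀ x≡h = u≢0 h (s≤s h≤n₀) (begin
      1ℚ - fromℕℚ h * y  ≡⟨ cong (λ z → 1ℚ - z * y) x≡h ⟨
      1ℚ - x * y         ≡⟨ cong (λ z → 1ℚ - z) x*y≡1 ⟩
      1ℚ - 1ℚ            ≡⟨ ℚₚ.+-inverseʳ 1ℚ ⟩
      0ℚ                 ∎)

    Ψ-b₀-at : Ψ b₀ y ≡ y ^ℚ D * V y
    Ψ-b₀-at = trans (sym partialFractions) (trans (cong (_* M y) (sym (pf x x-not-pole))) denominator)

  Ψ-b₀ : ∀ y → Ψ b₀ y ≡ y ^ℚ D * V y
  Ψ-b₀ = poly-ext (poly-Ψ b₀) (poly-* (poly-^ D poly-id) poly-V) (farPoint n₀) (farPoint-injective n₀)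
    (λ i → AtPoint.Ψ-b₀-at (farPoint n₀ i) (fromℕℚ (suc (n₀ ℕ.+ i)))
             (inv-inverseʳ _ (fromℕℚ-suc≢0 (n₀ ℕ.+ i)))
             (λ h h<N → u-farPoint-≢0 n₀ i h (ℕₚ.≤-pred h<N)))

  -- σ (Θ^k b₀) is the coefficient of y^(k+1) in y^D V / M = y^D / Π_h (1 - h y)^(e h).
  σ-Θ^-b₀ : ∀ k → k < D → σ (Θ^ k b₀) ≡ 0ℚ ^ℚ (D ∸ suc k) * V 0ℚ
  σ-Θ^-b₀ k k<D = σ-Θ^ k b₀ (λ y → y ^ℚ (D ∸ suc k) * V y) b₀-truncated (poly-* (poly-^ (D ∸ suc k) poly-id) poly-V) split
    where
    split : ∀ y → Ψ b₀ y ≡ y ^ℚ suc k * (y ^ℚ (D ∸ suc k) * V y)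
    split y = begin
      Ψ b₀ y                                          ≡⟨ Ψ-b₀ y ⟩
      y ^ℚ D * V y                                    ≡⟨ cong (λ n → y ^ℚ n * V y) (ℕₚ.m+[n∸m]≡n k<D) ⟨
      y ^ℚ (suc k ℕ.+ (D ∸ suc k)) * V y              ≡⟨ cong (_* V y) (^-distribˡ-+-* y (suc k) (D ∸ suc k)) ⟩
      y ^ℚ suc k * y ^ℚ (D ∸ suc k) * V y             ≡⟨ ℚₚ.*-assoc (y ^ℚ suc k) _ (V y) ⟩
      y ^ℚ suc k * (y ^ℚ (D ∸ suc k) * V y)           ∎

-- Partial fraction coefficients vanish beyond the order of the pole

Divisible : ℕ → ℕ → (ℚ → ℚ) → Set
Divisible h k f = Σ[ g ∈ (ℚ → ℚ) ] IsPoly g × (∀ y → f y ≡ u h y ^ℚ k * g y)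

divisible-0 : ∀ h k → Divisible h k (λ _ → 0ℚ)
divisible-0 h k = (λ _ → 0ℚ) , poly-const 0ℚ , (λ y → sym (ℚₚ.*-zeroʳ (u h y ^ℚ k)))

divisible-≗ : ∀ h k {f g} → Divisible h k f → (∀ y → f y ≡ g y) → Divisible h k g
divisible-≗ h k (q , pq , f≡) f≗g = q , pq , (λ y → trans (sym (f≗g y)) (f≡ y))

divisible-u^ : ∀ h k → Divisible h k (λ y → u h y ^ℚ k)
divisible-u^ h k = (λ _ → 1ℚ) , poly-const 1ℚ , (λ y → sym (ℚₚ.*-identityʳ (u h y ^ℚ k)))

divisible-+ : ∀ h k {f g} → Divisible h k f → Divisible h k g → Divisible h k (λ y → f y + g y)
divisible-+ h k (f′ , pf′ , f≡) (g′ , pg′ , g≡) = (λ y → f′ y + g′ y) , poly-+ pf′ pg′ ,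
  (λ y → trans (cong₂ _+_ (f≡ y) (g≡ y)) (sym (ℚₚ.*-distribˡ-+ (u h y ^ℚ k) (f′ y) (g′ y))))

divisible-sub : ∀ h k {f g} → Divisible h k f → Divisible h k g → Divisible h k (λ y → f y - g y)
divisible-sub h k (f′ , pf′ , f≡) (g′ , pg′ , g≡) = (λ y → f′ y - g′ y) , poly-sub pf′ pg′ ,
  (λ y → trans (cong₂ _-_ (f≡ y) (g≡ y)) (distrib (u h y ^ℚ k) (f′ y) (g′ y)))
  where
  distrib : ∀ a b c → a * b - a * c ≡ a * (b - c)
  distrib = solve-∀ ℚ-ring

divisible-*ˡ : ∀ h k {f g} → IsPoly f → Divisible h k g → Divisible h k (λ y → f y * g y)
divisible-*ˡ h k {f} pf (g′ , pg′ , g≡) = (λ y → f y * g′ y) , poly-* pf pg′ ,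
  (λ y → trans (cong (f y *_) (g≡ y)) (swap (f y) (u h y ^ℚ k) (g′ y)))
  where
  swap : ∀ a b c → a * (b * c) ≡ b * (a * c)
  swap = solve-∀ ℚ-ring

divisible-*ʳ : ∀ h k {f g} → Divisible h k f → IsPoly g → Divisible h k (λ y → f y * g y)
divisible-*ʳ h k {f} {g} df pg = divisible-≗ h k (divisible-*ˡ h k pg df) (λ y → ℚₚ.*-comm (g y) (f y))

divisible-≤ : ∀ h k k′ {f} → k′ ≤ k → Divisible h k f → Divisible h k′ f
divisible-≤ h k k′ k′≤k (g , pg , f≡) = (λ y → u h y ^ℚ (k ∸ k′) * g y) , poly-* (poly-^ (k ∸ k′) (poly-u h)) pg ,
  (λ y → trans (f≡ y) (begin
    u h y ^ℚ k * g y                                  ≡⟨ cong (λ z → u h y ^ℚ z * g y) (ℕₚ.m+[n∸m]≡n k′≤k) ⟨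
    u h y ^ℚ (k′ ℕ.+ (k ∸ k′)) * g y                  ≡⟨ cong (_* g y) (^-distribˡ-+-* (u h y) k′ (k ∸ k′)) ⟩
    u h y ^ℚ k′ * u h y ^ℚ (k ∸ k′) * g y             ≡⟨ ℚₚ.*-assoc (u h y ^ℚ k′) _ (g y) ⟩
    u h y ^ℚ k′ * (u h y ^ℚ (k ∸ k′) * g y)           ∎))

divisible-sum : ∀ h k N (F : ℕ → ℚ → ℚ) → (∀ i → i < N → Divisible h k (F i)) → Divisible h k (λ y → sumUpTo N (λ i → F i y))
divisible-sum h k zero    F dF = divisible-0 h k
divisible-sum h k (suc N) F dF =
  divisible-+ h k (divisible-sum h k N F (λ i i<N → dF i (ℕₚ.m<n⇒m<1+n i<N))) (dF N (ℕₚ.n<1+n N))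

divisible-prod : ∀ h k N (F : ℕ → ℚ → ℚ) → (∀ i → i < N → IsPoly (F i)) →
                 ∀ i₀ → i₀ < N → Divisible h k (F i₀) → Divisible h k (λ y → prodUpTo N (λ i → F i y))
divisible-prod h k (suc N) F pF i₀ i₀<1+N dF with i₀ ℕₚ.≟ N
... | yes refl = divisible-*ˡ h k (poly-prod N F (λ i i<N → pF i (ℕₚ.m<n⇒m<1+n i<N))) dF
... | no i₀≢N  = divisible-*ʳ h k
  (divisible-prod h k N F (λ i i<N → pF i (ℕₚ.m<n⇒m<1+n i<N)) i₀ (ℕₚ.≤∧≢⇒< (ℕₚ.≤-pred i₀<1+N) i₀≢N) dF)
  (pF N (ℕₚ.n<1+n N))

divisible-cancel : ∀ h t k {f} → IsPoly f → Divisible h (t ℕ.+ k) (λ y → u h y ^ℚ t * f y) → Divisible h k f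
divisible-cancel h t k {f} pf (g , pg , uᵗf≡) = g , pg ,
  poly-cancel h (λ y → u h y ^ℚ t) pf (poly-* (poly-^ k (poly-u h)) pg) (λ i → ^-≢0 _ t (u-farPoint-≢0 h i h ℕₚ.≤-refl))
    (λ y → begin
      u h y ^ℚ t * f y                       ≡⟨ uᵗf≡ y ⟩
      u h y ^ℚ (t ℕ.+ k) * g y               ≡⟨ cong (_* g y) (^-distribˡ-+-* (u h y) t k) ⟩
      u h y ^ℚ t * u h y ^ℚ k * g y          ≡⟨ ℚₚ.*-assoc (u h y ^ℚ t) (u h y ^ℚ k) (g y) ⟩
      u h y ^ℚ t * (u h y ^ℚ k * g y)        ∎)

module PoleOrder (m′ n₀ : ℕ) (e : ℕ → ℕ) (e≤m : ∀ h → e h ≤ suc m′)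
                 (a : ℕ → ℕ → ℚ) (pf : PartialFractionIdentity n₀ e (suc m′) a) where

  open PartialFractions m′ n₀ e e≤m a pf
  open LogSeries m′ N
  open GeneratingPolynomial m′ N

  module _ (p : ℕ) (h<N : suc p < N) where

    h : ℕ
    h = suc p

    β : ℕ → ℚ
    β = b₀ h

    y₀ : ℚ
    y₀ = inv (fromℕℚ h)

    others : ℚ → ℚ
    others y = sumUpTo N (update (λ h′ → S h′ m (b₀ h′) y * M-without h′ y) h 0ℚ)

    M-without-divisible : ∀ h′ → h′ ≢ h → Divisible h m (M-without h′)
    M-without-divisible h′ h′≢h =
      divisible-prod h m N (λ i y → update (λ h″ → u h″ y ^ℚ m) h′ 1ℚ i) (λ i _ → poly-update-u^ h′ i) h h<N
        (divisible-≗ h m (divisible-u^ h m) (λ y → sym (update-≢ (λ h″ → u h″ y ^ℚ m) h′ 1ℚ h (h′≢h ∘ sym))))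

    others-divisible : Divisible h m others
    others-divisible = divisible-sum h m N (λ h′ y → update (λ h″ → S h″ m (b₀ h″) y * M-without h″ y) h 0ℚ h′) term
      where
      term : ∀ h′ → h′ < N → Divisible h m (λ y → update (λ h″ → S h″ m (b₀ h″) y * M-without h″ y) h 0ℚ h′)
      term h′ _ with h′ ℕₚ.≟ h
      ... | yes refl = divisible-≗ h m (divisible-0 h m) (λ y → sym (update-≡ (λ h″ → S h″ m (b₀ h″) y * M-without h″ y) h 0ℚ))
      ... | no h′≢h  = divisible-≗ h m (divisible-*ˡ h m (poly-S h′ m (b₀ h′)) (M-without-divisible h′ h′≢h))
                         (λ y → sym (update-≢ (λ h″ → S h″ m (b₀ h″) y * M-without h″ y) h 0ℚ h′ h′≢h))

    main-term-divisible : Divisible h (m ∸ e h) (λ y → S h m β y * M-without h y)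
    main-term-divisible = divisible-≗ h (m ∸ e h)
      (divisible-sub h (m ∸ e h) (divisible-*ˡ h (m ∸ e h) (poly-^ D poly-id) V-divisible)
                               (divisible-≤ h m (m ∸ e h) (ℕₚ.m∸n≤m m (e h)) others-divisible))
      main-term
      where
      V-divisible : Divisible h (m ∸ e h) V
      V-divisible = divisible-prod h (m ∸ e h) N (λ h′ y → u h′ y ^ℚ (m ∸ e h′)) (λ h′ _ → poly-^ (m ∸ e h′) (poly-u h′))
                      h h<N (divisible-u^ h (m ∸ e h))
      main-term : ∀ y → y ^ℚ D * V y - others y ≡ S h m β y * M-without h y
      main-term y = begin
        y ^ℚ D * V y - others y                             ≡⟨ cong (_- others y) (Ψ-b₀ y) ⟨
        Ψ b₀ y - others y                                   ≡⟨ cong (_- others y) (sum-remove N _ h h<N) ⟩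
        (S h m β y * M-without h y + others y) - others y   ≡⟨ cancel (S h m β y * M-without h y) (others y) ⟩
        S h m β y * M-without h y                           ∎
        where
        cancel : ∀ a c → (a + c) - c ≡ a
        cancel = solve-∀ ℚ-ring

    M-without-y₀-≢0 : M-without h y₀ ≢ 0ℚ
    M-without-y₀-≢0 = prod-≢0 N _ factor
      where
      factor : ∀ h′ → h′ < N → update (λ h″ → u h″ y₀ ^ℚ m) h 1ℚ h′ ≢ 0ℚ
      factor h′ _ with h′ ℕₚ.≟ h
      ... | yes refl = λ eq → 1≢0 (trans (sym (update-≡ (λ h″ → u h″ y₀ ^ℚ m) h 1ℚ)) eq)
      ... | no h′≢h  = λ eq → ^-≢0 (u h′ y₀) m (h′≢h ∘ u-root h′ p)
                                (trans (sym (update-≢ (λ h″ → u h″ y₀ ^ℚ m) h 1ℚ h′ h′≢h)) eq)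

    top-coefficient-vanishes : ∀ n → Divisible h 1 (λ y → S h (suc n) β y * M-without h y) → β n ≡ 0ℚ
    top-coefficient-vanishes n (G , _ , S*M≡uG) =
      p*q≡0⇒q≡0 (y₀ ^ℚ suc n) (β n) (^-≢0 y₀ (suc n) (inv-≢0 (fromℕℚ h) (fromℕℚ-suc≢0 p)))
        (trans (ℚₚ.*-comm (y₀ ^ℚ suc n) (β n)) (p*q≡0⇒q≡0 (M-without h y₀) _ M-without-y₀-≢0 (begin
          M-without h y₀ * (β n * y₀ ^ℚ suc n)   ≡⟨ cong (M-without h y₀ *_) (S-at-root h n β y₀ (u-at-root p)) ⟨
          M-without h y₀ * S h (suc n) β y₀      ≡⟨ ℚₚ.*-comm (M-without h y₀) _ ⟩
          S h (suc n) β y₀ * M-without h y₀      ≡⟨ S*M≡uG y₀ ⟩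
          u h y₀ * 1ℚ * G y₀                     ≡⟨ cong (λ z → z * 1ℚ * G y₀) (u-at-root p) ⟩
          0ℚ * 1ℚ * G y₀                         ≡⟨ vanish (G y₀) ⟩
          0ℚ                                     ∎)))
      where
      vanish : ∀ g → 0ℚ * 1ℚ * g ≡ 0ℚ
      vanish = solve-∀ ℚ-ring

    -- Once β vanishes from m ∸ t on, S h m β = uᵗ S h (m ∸ t) β, so the divisibility of the main term by
    -- u^(t + 1) leaves a factor u on S h (m ∸ t) β * M-without h.
    top-vanishes : ∀ t → suc t ≤ m ∸ e h → (∀ j → m ∸ t ≤ j → β j ≡ 0ℚ) → β (m ∸ suc t) ≡ 0ℚ
    top-vanishes t 1+t≤m-e β≡0 = top-coefficient-vanishes n
      (divisible-cancel h t 1 (poly-* (poly-S h (suc n) β) (poly-M-without h))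
        (divisible-≗ h (t ℕ.+ 1) (divisible-≤ h (m ∸ e h) (t ℕ.+ 1) t+1≤m-e main-term-divisible) main≡uᵗ))
      where
      n = m ∸ suc t
      t+1≤m-e : t ℕ.+ 1 ≤ m ∸ e h
      t+1≤m-e = subst (_≤ m ∸ e h) (ℕₚ.+-comm 1 t) 1+t≤m-e
      1+t≤m : suc t ≤ m
      1+t≤m = ℕₚ.≤-trans 1+t≤m-e (ℕₚ.m∸n≤m m (e h))
      m∸t≡1+n : m ∸ t ≡ suc n
      m∸t≡1+n = ℕₚ.+-∸-assoc 1 1+t≤m
      S≡uᵗS : ∀ y → S h m β y ≡ u h y ^ℚ t * S h (suc n) β y
      S≡uᵗS y = subst (λ k → S h k β y ≡ u h y ^ℚ t * S h (suc n) β y)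
                  (trans (sym (ℕₚ.+-suc n t)) (ℕₚ.m∸n+n≡m 1+t≤m))
                  (S-+ h (suc n) t β (λ j 1+n≤j → β≡0 j (subst (_≤ j) (sym m∸t≡1+n) 1+n≤j)) y)
      main≡uᵗ : ∀ y → S h m β y * M-without h y ≡ u h y ^ℚ t * (S h (suc n) β y * M-without h y)
      main≡uᵗ y = trans (cong (_* M-without h y) (S≡uᵗS y)) (ℚₚ.*-assoc (u h y ^ℚ t) _ (M-without h y))

    vanishes-from : ∀ t → t ≤ m ∸ e h → ∀ j → m ∸ t ≤ j → β j ≡ 0ℚ
    vanishes-from zero    _        j m≤j = b₀-truncated h j m≤j
    vanishes-from (suc t) 1+t≤m-e j m∸[1+t]≤j with m ∸ suc t ℕₚ.≟ j
    ... | yes refl = top-vanishes t 1+t≤m-e (vanishes-from t (ℕₚ.<⇒≤ 1+t≤m-e))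
    ... | no ≢j    = vanishes-from t (ℕₚ.<⇒≤ 1+t≤m-e) j
      (subst (_≤ j) (sym (ℕₚ.+-∸-assoc 1 (ℕₚ.≤-trans 1+t≤m-e (ℕₚ.m∸n≤m m (e h))))) (ℕₚ.≤∧≢⇒< m∸[1+t]≤j ≢j))

    beyond-pole-order : ∀ j → e h ≤ j → b₀ h j ≡ 0ℚ
    beyond-pole-order j e≤j = vanishes-from (m ∸ e h) ℕₚ.≤-refl j (subst (_≤ j) (sym (ℕₚ.m∸[m∸n]≡n (e≤m h))) e≤j)

-- Block bookkeeping for the index n

Decreasing : ∀ {k} → (Fin k → ℕ) → Set
Decreasing ns = ∀ i j → i <ᶠ j → ns j < ns i

Decreasing-tail : ∀ {k} (ns : Fin (suc k) → ℕ) → Decreasing ns → Decreasing (λ i → ns (Fin.suc i))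
Decreasing-tail ns dec i j i<j = dec (Fin.suc i) (Fin.suc j) (s≤s i<j)

Decreasing⇒≤head : ∀ {k} (ns : Fin (suc k) → ℕ) → Decreasing ns → ∀ i → ns i ≤ ns zero
Decreasing⇒≤head ns dec zero       = ℕₚ.≤-refl
Decreasing⇒≤head ns dec (Fin.suc i) = ℕₚ.<⇒≤ (dec zero (Fin.suc i) (s≤s z≤n))

sumFinℕ-cong : ∀ {k} {f g : Fin k → ℕ} → (∀ i → f i ≡ g i) → sumFinℕ f ≡ sumFinℕ g
sumFinℕ-cong {zero}  eq = refl
sumFinℕ-cong {suc k} eq = cong₂ ℕ._+_ (eq zero) (sumFinℕ-cong (λ i → eq (Fin.suc i)))

sumFinℕ-mono : ∀ {k} {f g : Fin k → ℕ} → (∀ i → f i ≤ g i) → sumFinℕ f ≤ sumFinℕ g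
sumFinℕ-mono {zero}  le = z≤n
sumFinℕ-mono {suc k} le = ℕₚ.+-mono-≤ (le zero) (sumFinℕ-mono (λ i → le (Fin.suc i)))

sumFinℕ-zero : ∀ k → sumFinℕ {k} (λ _ → 0) ≡ 0
sumFinℕ-zero zero    = refl
sumFinℕ-zero (suc k) = sumFinℕ-zero k

sumFinℕ-distrib-+ : ∀ {k} (f g : Fin k → ℕ) → sumFinℕ (λ i → f i ℕ.+ g i) ≡ sumFinℕ f ℕ.+ sumFinℕ g
sumFinℕ-distrib-+ {zero}  f g = refl
sumFinℕ-distrib-+ {suc k} f g =
  trans (cong (f zero ℕ.+ g zero ℕ.+_) (sumFinℕ-distrib-+ (f ∘ Fin.suc) (g ∘ Fin.suc)))
        (shuffle (f zero) (g zero) (sumFinℕ (f ∘ Fin.suc)) (sumFinℕ (g ∘ Fin.suc)))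
  where
  shuffle : ∀ a b c d → a ℕ.+ b ℕ.+ (c ℕ.+ d) ≡ a ℕ.+ c ℕ.+ (b ℕ.+ d)
  shuffle = ℕ-solve-∀

sumℕ-cong< : ∀ N {f g} → (∀ p → p < N → f p ≡ g p) → sumℕ N f ≡ sumℕ N g
sumℕ-cong< zero    eq = refl
sumℕ-cong< (suc N) eq = cong₂ ℕ._+_ (sumℕ-cong< N (λ p p<N → eq p (ℕₚ.m<n⇒m<1+n p<N))) (eq N (ℕₚ.n<1+n N))

sumℕ-const : ∀ N f c → (∀ p → p < N → f p ≡ c) → sumℕ N f ≡ N ℕ.* c
sumℕ-const zero    f c eq = refl
sumℕ-const (suc N) f c eq =
  trans (cong₂ ℕ._+_ (sumℕ-const N f c (λ p p<N → eq p (ℕₚ.m<n⇒m<1+n p<N))) (eq N (ℕₚ.n<1+n N))) (ℕₚ.+-comm (N ℕ.* c) c)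

sumℕ-+ : ∀ a b f → sumℕ (a ℕ.+ b) f ≡ sumℕ a f ℕ.+ sumℕ b (λ p → f (a ℕ.+ p))
sumℕ-+ a zero    f = trans (cong (λ n → sumℕ n f) (ℕₚ.+-identityʳ a)) (sym (ℕₚ.+-identityʳ (sumℕ a f)))
sumℕ-+ a (suc b) f = trans (cong (λ n → sumℕ n f) (ℕₚ.+-suc a b))
  (trans (cong (ℕ._+ f (a ℕ.+ b)) (sumℕ-+ a b f)) (ℕₚ.+-assoc (sumℕ a f) _ (f (a ℕ.+ b))))

sumFinℕ≡sumℕ : ∀ m (f : ℕ → ℕ) → sumFinℕ {m} (λ j → f (toℕ j)) ≡ sumℕ m f
sumFinℕ≡sumℕ zero    f = refl
sumFinℕ≡sumℕ (suc m) f = trans (cong (f 0 ℕ.+_) (sumFinℕ≡sumℕ m (f ∘ suc))) (sym (head m f))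
  where
  head : ∀ N f → sumℕ (suc N) f ≡ f 0 ℕ.+ sumℕ N (f ∘ suc)
  head zero    f = ℕₚ.+-comm 0 (f 0)
  head (suc N) f = trans (cong (ℕ._+ f (suc N)) (head N f)) (ℕₚ.+-assoc (f 0) _ (f (suc N)))

sumℕ-sumFinℕ-comm : ∀ N {k} (F : ℕ → Fin k → ℕ) → sumℕ N (λ h → sumFinℕ (F h)) ≡ sumFinℕ (λ i → sumℕ N (λ h → F h i))
sumℕ-sumFinℕ-comm zero    {k} F = sym (sumFinℕ-zero k)
sumℕ-sumFinℕ-comm (suc N)     F = trans (cong (ℕ._+ sumFinℕ (F N)) (sumℕ-sumFinℕ-comm N F))
  (sym (sumFinℕ-distrib-+ (λ i → sumℕ N (λ h → F h i)) (F N)))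

sumℕ-indicator : ∀ N c r → c < N → sumℕ N (λ h → if h ≤ᵇ c then r else 0) ≡ suc c ℕ.* r
sumℕ-indicator N c r c<N = begin
  sumℕ N f                                                    ≡⟨ cong (λ n → sumℕ n f) (ℕₚ.m+[n∸m]≡n c<N) ⟨
  sumℕ (suc c ℕ.+ (N ∸ suc c)) f                              ≡⟨ sumℕ-+ (suc c) (N ∸ suc c) f ⟩
  sumℕ (suc c) f ℕ.+ sumℕ (N ∸ suc c) (λ p → f (suc c ℕ.+ p))  ≡⟨ cong₂ ℕ._+_ (sumℕ-const (suc c) f r below) (sumℕ-const (N ∸ suc c) _ 0 above) ⟩
  suc c ℕ.* r ℕ.+ (N ∸ suc c) ℕ.* 0                           ≡⟨ cong (suc c ℕ.* r ℕ.+_) (ℕₚ.*-zeroʳ (N ∸ suc c)) ⟩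
  suc c ℕ.* r ℕ.+ 0                                           ≡⟨ ℕₚ.+-identityʳ _ ⟩
  suc c ℕ.* r                                                 ∎
  where
  f = λ h → if h ≤ᵇ c then r else 0
  below : ∀ h → h < suc c → f h ≡ r
  below h h<1+c = cong (if_then r else 0) (dec-true (h ℕₚ.≤? c) (ℕₚ.≤-pred h<1+c))
  above : ∀ p → p < N ∸ suc c → f (suc c ℕ.+ p) ≡ 0
  above p _ = cong (if_then r else 0) (dec-false (suc c ℕ.+ p ℕₚ.≤? c) (ℕₚ.<⇒≱ (s≤s (ℕₚ.m≤m+n c p))))

indicator≤ : ∀ b r → (if b then r else 0) ≤ r
indicator≤ true  r = ℕₚ.≤-refl
indicator≤ false r = z≤n

expo≤sum : ∀ {k} (r ns : Fin k → ℕ) h → expo r ns h ≤ sumFinℕ r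
expo≤sum r ns h = sumFinℕ-mono (λ i → indicator≤ (h ≤ᵇ ns i) (r i))

expo-beyond : ∀ {k} (r ns : Fin k → ℕ) h → (∀ i → ns i < h) → expo r ns h ≡ 0
expo-beyond {k} r ns h ns<h = trans (sumFinℕ-cong (λ i → cong (if_then r i else 0) (dec-false (h ℕₚ.≤? ns i) (ℕₚ.<⇒≱ (ns<h i)))))
                                    (sumFinℕ-zero k)

blockEntry-head : ∀ {k} (r ns : Fin (suc k) → ℕ) p → p < r zero → blockEntry r ns p ≡ ns zero
blockEntry-head r ns p p<r₀ = cong (if_then ns zero else blockEntry (r ∘ Fin.suc) (ns ∘ Fin.suc) (p ∸ r zero)) (dec-true (p ℕₚ.<? r zero) p<r₀)

blockEntry-tail : ∀ {k} (r ns : Fin (suc k) → ℕ) p → ¬ p < r zero →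
                  blockEntry r ns p ≡ blockEntry (r ∘ Fin.suc) (ns ∘ Fin.suc) (p ∸ r zero)
blockEntry-tail r ns p p≮r₀ = cong (if_then ns zero else blockEntry (r ∘ Fin.suc) (ns ∘ Fin.suc) (p ∸ r zero)) (dec-false (p ℕₚ.<? r zero) p≮r₀)

expo≤block : ∀ {k} (r ns : Fin k → ℕ) → Decreasing ns → ∀ p h → blockEntry r ns p < h → expo r ns h ≤ p
expo≤block {zero}  r ns dec p h _ = z≤n
expo≤block {suc k} r ns dec p h entry<h with p ℕₚ.<? r zero
... | yes p<r₀ = ℕₚ.≤-trans (ℕₚ.≤-reflexive (expo-beyond r ns h ns<h)) z≤n
  where
  ns<h : ∀ i → ns i < h
  ns<h i = ℕₚ.≤-<-trans (Decreasing⇒≤head ns dec i) (subst (_< h) (blockEntry-head r ns p p<r₀) entry<h)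
... | no p≮r₀ =
  ℕₚ.≤-trans (ℕₚ.+-mono-≤ (indicator≤ (h ≤ᵇ ns zero) (r zero)) tail≤) (ℕₚ.≤-reflexive (ℕₚ.m+[n∸m]≡n (ℕₚ.≮⇒≥ p≮r₀)))
  where
  tail≤ : expo (r ∘ Fin.suc) (ns ∘ Fin.suc) h ≤ p ∸ r zero
  tail≤ = expo≤block (r ∘ Fin.suc) (ns ∘ Fin.suc) (Decreasing-tail ns dec) (p ∸ r zero) h
            (subst (_< h) (blockEntry-tail r ns p p≮r₀) entry<h)

sum-blockEntry : ∀ {k} (r ns : Fin k → ℕ) → sumℕ (sumFinℕ r) (λ p → suc (blockEntry r ns p)) ≡ sumFinℕ (λ i → r i ℕ.* suc (ns i))
sum-blockEntry {zero}  r ns = refl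
sum-blockEntry {suc k} r ns = begin
  sumℕ (r₀ ℕ.+ R) F                                     ≡⟨ sumℕ-+ r₀ R F ⟩
  sumℕ r₀ F ℕ.+ sumℕ R (λ p → F (r₀ ℕ.+ p))             ≡⟨ cong₂ ℕ._+_ (sumℕ-const r₀ F (suc (ns zero)) head) (sumℕ-cong< R tail) ⟩
  r₀ ℕ.* suc (ns zero) ℕ.+ sumℕ R (λ p → suc (blockEntry (r ∘ Fin.suc) (ns ∘ Fin.suc) p))
                                                        ≡⟨ cong (r₀ ℕ.* suc (ns zero) ℕ.+_) (sum-blockEntry (r ∘ Fin.suc) (ns ∘ Fin.suc)) ⟩
  sumFinℕ (λ i → r i ℕ.* suc (ns i))                    ∎
  where
  r₀ = r zero
  R = sumFinℕ (r ∘ Fin.suc)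
  F = λ p → suc (blockEntry r ns p)
  head : ∀ p → p < r₀ → F p ≡ suc (ns zero)
  head p p<r₀ = cong suc (blockEntry-head r ns p p<r₀)
  tail : ∀ p → p < R → F (r₀ ℕ.+ p) ≡ suc (blockEntry (r ∘ Fin.suc) (ns ∘ Fin.suc) p)
  tail p _ = cong suc (trans (blockEntry-tail r ns (r₀ ℕ.+ p) (ℕₚ.≤⇒≯ (ℕₚ.m≤m+n r₀ p)))
                             (cong (blockEntry (r ∘ Fin.suc) (ns ∘ Fin.suc)) (ℕₚ.m+n∸m≡n r₀ p)))

sum-expo : ∀ {k} (r ns : Fin (suc k) → ℕ) → Decreasing ns → sumℕ (suc (ns zero)) (expo r ns) ≡ sumFinℕ (λ i → r i ℕ.* suc (ns i))
sum-expo r ns dec = trans (sumℕ-sumFinℕ-comm (suc (ns zero)) (λ h i → if h ≤ᵇ ns i then r i else 0))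
  (sumFinℕ-cong (λ i → trans (sumℕ-indicator (suc (ns zero)) (ns i) (r i) (s≤s (Decreasing⇒≤head ns dec i)))
                             (ℕₚ.*-comm (suc (ns i)) (r i))))

-- Σ_p (n_p + 1) = Σ_{h ≤ n₀} e_h: both count the pairs (i, h) with h ≤ n_i, r_i times each.
weight≡sum-expo : ∀ {k} (r ns : Fin (suc k) → ℕ) → Decreasing ns → ∀ m → sumFinℕ r ≡ m →
  sumFinℕ {m} (λ p → suc (blockEntry r ns (toℕ p))) ≡ sumℕ (suc (ns zero)) (expo r ns)
weight≡sum-expo r ns dec m Σr≡m = begin
  sumFinℕ {m} (λ p → suc (blockEntry r ns (toℕ p)))       ≡⟨ sumFinℕ≡sumℕ m (λ p → suc (blockEntry r ns p)) ⟩
  sumℕ m (λ p → suc (blockEntry r ns p))                  ≡⟨ cong (λ n → sumℕ n (λ p → suc (blockEntry r ns p))) Σr≡m ⟨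
  sumℕ (sumFinℕ r) (λ p → suc (blockEntry r ns p))        ≡⟨ sum-blockEntry r ns ⟩
  sumFinℕ (λ i → r i ℕ.* suc (ns i))                      ≡⟨ sum-expo r ns dec ⟨
  sumℕ (suc (ns zero)) (expo r ns)                        ∎

module Padé (m′ s : ℕ) (r ns : Fin (suc s) → ℕ) (Σr≡m : sumFinℕ r ≡ suc m′) (dec : Decreasing ns)
            (a : ℕ → ℕ → ℚ) (pf : IsPartialFraction r ns (suc m′) a) where

  n₀ : ℕ
  n₀ = ns zero

  e : ℕ → ℕ
  e = expo r ns

  e≤m : ∀ h → e h ≤ suc m′
  e≤m h = subst (e h ≤_) Σr≡m (expo≤sum r ns h)

  open PartialFractions m′ n₀ e e≤m a pf
  open LogSeries m′ N
  open GeneratingPolynomial m′ N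
  open PoleOrder m′ n₀ e e≤m a pf

  weight : ℕ
  weight = sumFinℕ {m} (λ p → suc (blockEntry r ns (toℕ p)))

  weight≡D : weight ≡ D
  weight≡D = weight≡sum-expo r ns dec m Σr≡m

  A : Fin m → Series
  A j = padeCoeff n₀ a (toℕ j)

  padeCoeff≈coeffPoly-b₀ : ∀ j → j < m → padeCoeff n₀ a j ≈ₛ coeffPoly b₀ j
  padeCoeff≈coeffPoly-b₀ j j<m k =
    cong (inv (fromℕℚ (j !)) *_) (sum-cong N (λ h → cong (_* (onePlusZ ^ₛ h) k) (sym (b₀-below h j j<m))))

  R≈series-b₀ : Rseries m n₀ a ≈ₛ series b₀
  R≈series-b₀ k = sum-cong< m (λ j j<m → *ₛ-congˡ (log1p ^ₛ j) (padeCoeff≈coeffPoly-b₀ j j<m) k)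

  b₀-beyond-pole : ∀ h j → 0 < h → h < N → e h ≤ j → b₀ h j ≡ 0ℚ
  b₀-beyond-pole (suc p) j _ h<N = beyond-pole-order p h<N j

  degree : ∀ j k → blockEntry r ns (toℕ j) < k → A j k ≡ 0ℚ
  degree j k entry<k = trans (padeCoeff≈coeffPoly-b₀ (toℕ j) (Finₚ.toℕ<n j) k)
    (trans (cong (inv (fromℕℚ (toℕ j !)) *_) (sum-zero N term)) (ℚₚ.*-zeroʳ (inv (fromℕℚ (toℕ j !)))))
    where
    term : ∀ h → h < N → b₀ h (toℕ j) * (onePlusZ ^ₛ h) k ≡ 0ℚ
    term h h<N with h ℕₚ.<? k
    ... | yes h<k = trans (cong (b₀ h (toℕ j) *_) (onePlusZ^-beyond h k h<k)) (ℚₚ.*-zeroʳ (b₀ h (toℕ j)))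
    ... | no h≮k  = trans (cong (_* (onePlusZ ^ₛ h) k) (b₀-beyond-pole h (toℕ j) 0<h h<N e≤j)) (ℚₚ.*-zeroˡ ((onePlusZ ^ₛ h) k))
      where
      k≤h = ℕₚ.≮⇒≥ h≮k
      0<h = ℕₚ.<-≤-trans (ℕₚ.≤-<-trans z≤n entry<k) k≤h
      e≤j = expo≤block r ns dec (toℕ j) h (ℕₚ.<-≤-trans entry<k k≤h)

  σ-Θ^-b₀-weight : ∀ i → i < weight → σ (Θ^ i b₀) ≡ 0ℚ ^ℚ (weight ∸ suc i) * V 0ℚ
  σ-Θ^-b₀-weight i i<w = subst (λ w → σ (Θ^ i b₀) ≡ 0ℚ ^ℚ (w ∸ suc i) * V 0ℚ) (sym weight≡D)
                           (σ-Θ^-b₀ i (subst (i <_) weight≡D i<w))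

  σ-Θ^-b₀-below : ∀ i → i < weight ∸ 1 → σ (Θ^ i b₀) ≡ 0ℚ
  σ-Θ^-b₀-below i i<w-1 = begin
    σ (Θ^ i b₀)                            ≡⟨ σ-Θ^-b₀-weight i (ℕₚ.m<n⇒m<1+n i<w-1) ⟩
    0ℚ ^ℚ (weight ∸ suc i) * V 0ℚ          ≡⟨ cong (λ n → 0ℚ ^ℚ n * V 0ℚ) (ℕₚ.+-∸-assoc 1 i<w-1) ⟩
    0ℚ ^ℚ suc (weight ∸ 1 ∸ suc i) * V 0ℚ  ≡⟨ cong (_* V 0ℚ) (0^suc≡0 (weight ∸ 1 ∸ suc i)) ⟩
    0ℚ * V 0ℚ                              ≡⟨ ℚₚ.*-zeroˡ (V 0ℚ) ⟩
    0ℚ                                     ∎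

  σ-Θ^-b₀-top : σ (Θ^ (weight ∸ 1) b₀) ≡ 1ℚ
  σ-Θ^-b₀-top = begin
    σ (Θ^ (weight ∸ 1) b₀)               ≡⟨ σ-Θ^-b₀-weight (weight ∸ 1) (ℕₚ.n<1+n _) ⟩
    0ℚ ^ℚ (weight ∸ weight) * V 0ℚ       ≡⟨ cong (λ n → 0ℚ ^ℚ n * V 0ℚ) (ℕₚ.n∸n≡0 weight) ⟩
    1ℚ * V 0ℚ                            ≡⟨ trans (ℚₚ.*-identityˡ (V 0ℚ)) V-0 ⟩
    1ℚ                                   ∎

  order : ∀ k → k < weight ∸ 1 → Rseries m n₀ a k ≡ 0ℚ
  order k k<w-1 = trans (R≈series-b₀ k) (series-order (weight ∸ 1) b₀ b₀-truncated σ-Θ^-b₀-below k k<w-1)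

  nontrivial : ¬ (∀ j k → A j k ≡ 0ℚ)
  nontrivial A≡0 = 1≢0 (trans (sym σ-Θ^-b₀-top) (series-zero (weight ∸ 1) b₀ b₀-truncated series-b₀≈0))
    where
    padeCoeff≡0 : ∀ j → j < m → ∀ k → padeCoeff n₀ a j k ≡ 0ℚ
    padeCoeff≡0 j j<m k = subst (λ i → padeCoeff n₀ a i k ≡ 0ℚ) (Finₚ.toℕ-fromℕ< j<m) (A≡0 (fromℕ< j<m) k)
    series-b₀≈0 : series b₀ ≈ₛ 0ₛ
    series-b₀≈0 k = trans (sym (R≈series-b₀ k))
      (sum-zero m (λ j j<m → trans (*ₛ-congˡ (log1p ^ₛ j) (padeCoeff≡0 j j<m) k) (*ₛ-zeroˡ (log1p ^ₛ j) k)))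

  R≡ΣA·log^ : ∀ k → Rseries m n₀ a k ≡ sumFinₛ (λ j → A j *ₛ logPowers m j) k
  R≡ΣA·log^ k = sym (sumFinℚ≡sumUpTo m (λ j → (padeCoeff n₀ a j *ₛ (log1p ^ₛ j)) k))

-- The hypothesis 2 ≤ m is only used to exclude m = 0.
proposition5p3 : (m s : ℕ) (r ns : Fin (suc s) → ℕ) →
    2 ≤ m → sumFinℕ r ≡ m →
    (∀ i j → i <ᶠ j → ns j < ns i) →
    (a : ℕ → ℕ → ℚ) → IsPartialFraction r ns m a →
    IsPadeApprox {m} (λ p → blockEntry r ns (toℕ p)) (logPowers m)
    (Rseries m (ns zero) a)
proposition5p3 (suc m′) s r ns _ Σr≡m dec a pf = A , degree , nontrivial , R≡ΣA·log^ , order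
  where open Padé m′ s r ns Σr≡m dec a pf
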